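{- Let $q=p^n\ge 3$ with $p$ prime. Let $V[x]$ be the $\mathbb{F}_q$-vector space of polynomials $f\in\mathbb{F}_q[x]$ of degree at most $q-2$ with $f(0)=0$, and let $A:V[x]\to V[x]$ be the linear map $A(f)(x)=f(x+1)-f(1)$. Then the eigenspace $\ker(A-I)$ is spanned by the monomials $x,x^p,x^{p^2},\ldots,x^{p^{n-1}}$ together with the polynomials $(x^p-x)^m$ for $m=2,3,\ldots,p^{n-1}-1$ with $m$ not a power of $p$; in particular $\dim\ker(A-I)=p^{n-1}$.
   Context: Polynomials in $V[x]$ are formal polynomials; $f(x+1)$ denotes formal substitution; $I$ is the identity map of $V[x]$. -}

module Defs where

open import Level using (_⊔_)
open import Algebra.Bundles using (CommutativeRing)
open import Data.Nat as ℕ using (ℕ; zero; suc; _∸_; _^_)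
open import Data.Nat.Properties using (_≟_)
open import Data.Fin using (Fin)
open import Data.List using (List; []; _∷_; map; _++_; filter; upTo; length; zipWith; foldr)
open import Data.List.Relation.Unary.Any using (Any; any?)
open import Data.Product using (Σ; ∃; _×_)
open import Relation.Nullary using (¬_; ¬?)
open import Relation.Binary.PropositionalEquality using (_≡_)

IsFieldCR : ∀ {c ℓ} → CommutativeRing c ℓ → Set (c ⊔ ℓ)
IsFieldCR R = ¬ (1# ≈ 0#) × (∀ x → ¬ (x ≈ 0#) → ∃ λ y → x * y ≈ 1#)
  where open CommutativeRing R

HasCardinality : ∀ {c ℓ} → CommutativeRing c ℓ → ℕ → Set (c ⊔ ℓ)
HasCardinality R q =
  Σ (Fin q → Carrier) λ e →
    (∀ i j → e i ≈ e j → i ≡ j) × (∀ x → ∃ λ i → e i ≈ x)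
  where open CommutativeRing R

-- m is a power of p  (∃ k ≤ m with p^k = m; for p ≥ 2 this is the same as ∃ k. p^k = m)
IsPowerOf : ℕ → ℕ → Set
IsPowerOf p m = Any (λ k → p ^ k ≡ m) (upTo (suc m))

rangeℕ : ℕ → ℕ → List ℕ
rangeℕ a b = map (ℕ._+ a) (upTo (suc b ∸ a))

-- Formal polynomials over a commutative ring, as dense coefficient lists
-- (entry i is the coefficient of x^i; trailing zeros allowed).
module Poly {c ℓ} (R : CommutativeRing c ℓ) where
  open CommutativeRing R

  Pol : Set c
  Pol = List Carrier

  coeff : Pol → ℕ → Carrier
  coeff []       _       = 0#
  coeff (a ∷ f)  zero    = a
  coeff (a ∷ f)  (suc k) = coeff f k

  _≈P_ : Pol → Pol → Set ℓ
  f ≈P g = ∀ k → coeff f k ≈ coeff g k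

  infixl 6 _+P_ _-P_
  infixl 7 _*P_ _·P_

  _+P_ : Pol → Pol → Pol
  []      +P g       = g
  (a ∷ f) +P []      = a ∷ f
  (a ∷ f) +P (b ∷ g) = (a + b) ∷ (f +P g)

  _·P_ : Carrier → Pol → Pol
  a ·P f = map (a *_) f

  negP : Pol → Pol
  negP f = map -_ f

  _-P_ : Pol → Pol → Pol
  f -P g = f +P negP g

  shiftX : Pol → Pol
  shiftX f = 0# ∷ f

  _*P_ : Pol → Pol → Pol
  []      *P g = []
  (a ∷ f) *P g = (a ·P g) +P shiftX (f *P g)

  const : Carrier → Pol
  const a = a ∷ []

  X : Pol
  X = 0# ∷ 1# ∷ []

  oneP : Pol
  oneP = 1# ∷ []

  _^P_ : Pol → ℕ → Pol
  f ^P zero    = oneP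
  f ^P (suc n) = f *P (f ^P n)

  mono : ℕ → Pol
  mono k = X ^P k

  eval : Pol → Carrier → Carrier
  eval []      _ = 0#
  eval (a ∷ f) t = a + t * eval f t

  compose : Pol → Pol → Pol
  compose []      g = []
  compose (a ∷ f) g = const a +P (g *P compose f g)

  shift1 : Pol → Pol
  shift1 f = compose f (X +P oneP)

  Amap : Pol → Pol
  Amap f = shift1 f -P const (eval f 1#)

  InV : ℕ → Pol → Set ℓ
  InV d f = (∀ k → d ℕ.< k → coeff f k ≈ 0#) × coeff f 0 ≈ 0#

  lincomb : List Carrier → List Pol → Pol
  lincomb cs bs = foldr _+P_ [] (zipWith _·P_ cs bs)

  AllZero : List Carrier → Set ℓ
  AllZero cs = ∀ k → coeff cs k ≈ 0#

  family : ℕ → ℕ → List Pol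
  family p n =
    map (λ j → mono (p ^ j)) (upTo n)
    ++ map (λ m → (mono p -P X) ^P m)
           (filter (λ m → ¬? (any? (λ k → p ^ k ≟ m) (upTo (suc m))))
                   (rangeℕ 2 (p ^ (n ∸ 1) ∸ 1)))

-- Write y = x^p - x. The field has characteristic p: translation by 1 permutes it, which forces
-- (p · 1)^n = p^n · 1 = 0. Hence (x + 1)^(p^j) = x^(p^j) + 1 by the Frobenius identity, so the monomials x^(p^j)
-- and all powers of y (which satisfies y(x + 1) = y(x) and y(1) = 0) are fixed by A.
-- Conversely, if f is fixed and has degree D ≥ 2, comparing the coefficients of x^(D-1) gives
-- D f_D = 0, so D is 1 or a multiple of p. The family has a monic member of each such degree
-- D ≤ q - 2 (x^D if D is a power of p, y^(D/p) otherwise), and subtracting a multiple of it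
-- lowers the degree. The members have pairwise distinct degrees, hence are independent, and
-- counting the non-powers of p in [2, p^(n-1) - 1] shows that there are p^(n-1) of them.

module Submission where

open import Defs
open import Level using (_⊔_)
open import Algebra.Bundles using (CommutativeRing)
open import Data.Nat as ℕ using (ℕ; zero; suc; _<_; _≤_; s≤s; z≤n)
import Data.Nat.Properties as ℕ
open import Data.Nat.Divisibility using (_∣_; _∣?_; divides)
open import Data.Nat.Primality using (Prime)
open import Data.List using (List; []; _∷_; length; replicate; map; _++_; filter; upTo)
open import Data.Product using (_,_; proj₁; proj₂; ∃)
open import Data.Sum using (_⊎_; inj₁; inj₂)
open import Relation.Nullary using (¬_; ¬?; Dec; yes; no; contradiction)
open import Relation.Binary.PropositionalEquality as ≡ using (_≡_; _≢_)

module Arithmetic where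
  open import Data.Nat
  open import Data.Nat.Properties
  open import Data.Nat.Divisibility
  open import Data.Nat.Primality
  open import Data.Nat.Coprimality using (Coprime; coprime-divisor)
  open import Data.Nat.Combinatorics
  open import Data.Nat.Combinatorics.Specification using (nCk≡n!/k![n-k]!)
  open import Data.Nat.DivMod using (m/n*n≡m)
  open import Data.List using ([_])
  open import Data.List.Properties using (length-map; length-upTo; length-++; map-++; upTo-∷ʳ; filter-++; filter-accept; filter-reject)
  open import Data.List.Membership.Propositional using (_∈_; find; lose)
  open import Data.List.Membership.Propositional.Properties using (∈-map⁻; ∈-map⁺; ∈-upTo⁻; ∈-upTo⁺)
  open import Data.List.Relation.Unary.Any using (any?)
  open import Data.Product using (_×_)
  import Data.Sum as Sum
  open import Function using (_∘_)
  open import Relation.Binary.Definitions using (tri<; tri≈; tri>)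
  open import Relation.Binary.PropositionalEquality hiding ([_])

  prime⇒2≤ : ∀ {p} → Prime p → 2 ≤ p
  prime⇒2≤ {p} pr = nonTrivial⇒n>1 p {{prime⇒nonTrivial pr}}

  prime∤⇒coprime : ∀ {p m} → Prime p → ¬ p ∣ m → Coprime p m
  prime∤⇒coprime pr p∤m (d∣p , d∣m) with prime⇒irreducible pr d∣p
  ... | inj₁ d≡1 = d≡1
  ... | inj₂ refl = contradiction d∣m p∤m

  prime∤! : ∀ {p} → Prime p → ∀ m → m < p → ¬ p ∣ m !
  prime∤! pr zero m<p p∣1 = <⇒≱ (prime⇒2≤ pr) (∣⇒≤ p∣1)
  prime∤! pr (suc m) m<p p∣m! =
    Sum.[ (λ p∣1+m → <⇒≱ m<p (∣⇒≤ p∣1+m)) , prime∤! pr m (<-trans (n<1+n m) m<p) ]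
    (euclidsLemma (suc m) (m !) pr p∣m!)

  prime∣choose : ∀ {p k} → Prime p → 0 < k → k < p → p ∣ p C k
  prime∣choose {p@(suc p′)} {k} pr 0<k k<p =
    coprime-divisor (prime∤⇒coprime pr p∤k![p-k]!) (subst (p ∣_) (sym p!≡) (m∣m*n (p′ !)))
    where
    k≤p = <⇒≤ k<p
    p!≡ : k ! * (p ∸ k) ! * (p C k) ≡ p !
    p!≡ = trans (*-comm (k ! * (p ∸ k) !) (p C k))
         (trans (cong (_* (k ! * (p ∸ k) !)) (nCk≡n!/k![n-k]! k≤p))
                (m/n*n≡m {{k !* (p ∸ k) !≢0}} (k![n∸k]!∣n! k≤p)))
    p∤k![p-k]! : ¬ p ∣ k ! * (p ∸ k) !
    p∤k![p-k]! p∣ = Sum.[ prime∤! pr k k<p , prime∤! pr (p ∸ k) (∸-monoʳ-< 0<k k≤p) ]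
                    (euclidsLemma (k !) ((p ∸ k) !) pr p∣)

  ∈-rangeℕ⁻ : ∀ {m a b} → m ∈ rangeℕ a b → a ≤ m × m ≤ b
  ∈-rangeℕ⁻ {m} {a} {b} m∈ with ∈-map⁻ (_+ a) m∈
  ... | i , i∈ , refl = m≤n+m a i , ≤-pred (subst (i + a <_) (m∸n+n≡m a≤1+b) (+-monoˡ-< a i<1+b∸a))
    where
    i<1+b∸a = ∈-upTo⁻ i∈
    a≤1+b : a ≤ suc b
    a≤1+b with a ≤? suc b
    ... | yes a≤1+b = a≤1+b
    ... | no a≰1+b = contradiction (subst (i <_) (m≤n⇒m∸n≡0 (<⇒≤ (≰⇒> a≰1+b))) i<1+b∸a) n≮0

  ∈-rangeℕ⁺ : ∀ {m a b} → a ≤ m → m ≤ b → m ∈ rangeℕ a b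
  ∈-rangeℕ⁺ {m} {a} {b} a≤m m≤b =
    subst (_∈ rangeℕ a b) (m∸n+n≡m a≤m) (∈-map⁺ (_+ a) (∈-upTo⁺ (∸-monoˡ-< (s≤s m≤b) a≤m)))

  module PowersOf (p : ℕ) (2≤p : 2 ≤ p) where
    instance
      p≢0 : NonZero p
      p≢0 = >-nonZero (≤-trans (s≤s z≤n) 2≤p)

    n<p^n : ∀ n → n < p ^ n
    n<p^n zero    = s≤s z≤n
    n<p^n (suc n) = begin-strict
      suc n             <⟨ s≤s (n<p^n n) ⟩
      1 + p ^ n         ≤⟨ +-monoˡ-≤ (p ^ n) (m^n>0 p n) ⟩
      p ^ n + p ^ n     ≡⟨ cong (p ^ n +_) (sym (+-identityʳ _)) ⟩
      2 * p ^ n         ≤⟨ *-monoˡ-≤ (p ^ n) 2≤p ⟩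
      p * p ^ n         ∎
      where open ≤-Reasoning

    ^-between-unique : ∀ {i j m} → p ^ j ≤ m → m < p ^ suc j → p ^ i ≡ m → i ≡ j
    ^-between-unique {i} {j} p^j≤m m<p^1+j p^i≡m with <-cmp i j
    ... | tri< i<j _ _ = contradiction (≤-trans p^j≤m (≤-reflexive (sym p^i≡m))) (<⇒≱ (^-monoʳ-< p 2≤p i<j))
    ... | tri≈ _ i≡j _ = i≡j
    ... | tri> _ _ j<i = contradiction (≤-trans (^-monoʳ-≤ p j<i) (≤-reflexive p^i≡m)) (<⇒≱ m<p^1+j)

    ^-injective : ∀ {i j} → p ^ i ≡ p ^ j → i ≡ j
    ^-injective {j = j} = ^-between-unique ≤-refl (^-monoʳ-< p 2≤p (n<1+n j))

    2≤p^1+ : ∀ j → 2 ≤ p ^ suc j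
    2≤p^1+ j = ≤-trans 2≤p (m≤m*n p (p ^ j) {{m^n≢0 p j}})

    isPowerOf? : ∀ m → Dec (IsPowerOf p m)
    isPowerOf? m = any? (λ k → p ^ k ≟ m) (upTo (suc m))

    isNonPowerOf? : ∀ m → Dec (¬ IsPowerOf p m)
    isNonPowerOf? m = ¬? (isPowerOf? m)

    IsPowerOf⁺ : ∀ {k m} → p ^ k ≡ m → IsPowerOf p m
    IsPowerOf⁺ {k} p^k≡m = lose (∈-upTo⁺ (m<n⇒m<1+n (subst (k <_) p^k≡m (n<p^n k)))) p^k≡m

    IsPowerOf⁻ : ∀ {m} → IsPowerOf p m → ∃ λ k → p ^ k ≡ m
    IsPowerOf⁻ pow with find pow
    ... | k , _ , p^k≡m = k , p^k≡m

  module PrimePowerBounds (p n : ℕ) (2≤p : 2 ≤ p) (3≤q : 3 ≤ p ^ n) where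
    open PowersOf p 2≤p

    q = p ^ n
    a = p ^ (n ∸ 1)

    1≤n : 1 ≤ n
    1≤n = 3≤p^m⇒1≤m n 3≤q
      where
      3≤p^m⇒1≤m : ∀ m → 3 ≤ p ^ m → 1 ≤ m
      3≤p^m⇒1≤m zero    (s≤s ())
      3≤p^m⇒1≤m (suc m) _ = s≤s z≤n

    q≡a*p : q ≡ a * p
    q≡a*p = p^m≡p^[m∸1]*p n 1≤n
      where
      p^m≡p^[m∸1]*p : ∀ m → 1 ≤ m → p ^ m ≡ p ^ (m ∸ 1) * p
      p^m≡p^[m∸1]*p (suc m) _ = *-comm p (p ^ m)

    a+2≤q : a + 2 ≤ q
    a+2≤q with 2 ≤? a
    ... | yes 2≤a = begin
          a + 2       ≤⟨ +-monoʳ-≤ a 2≤a ⟩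
          a + a       ≡⟨ cong (a +_) (sym (+-identityʳ a)) ⟩
          2 * a       ≤⟨ *-monoˡ-≤ a 2≤p ⟩
          p * a       ≡⟨ trans (*-comm p a) (sym q≡a*p) ⟩
          q           ∎
      where open ≤-Reasoning
    ... | no 2≰a = subst (λ z → z + 2 ≤ q) (sym a≡1) 3≤q
      where a≡1 : a ≡ 1
            a≡1 = ≤-antisym (≤-pred (≰⇒> 2≰a)) (m^n>0 p (n ∸ 1))

    q∸2<q : q ∸ 2 < q
    q∸2<q = ∸-monoʳ-< {q} {2} {0} (s≤s z≤n) (≤-trans (s≤s (s≤s z≤n)) 3≤q)

    p^j≤q∸2 : ∀ j → j < n → p ^ j ≤ q ∸ 2
    p^j≤q∸2 j j<n = ≤-trans (^-monoʳ-≤ p (∸-monoˡ-≤ 1 j<n)) (subst (_≤ q ∸ 2) (m+n∸n≡m a 2) (∸-monoˡ-≤ 2 a+2≤q))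

    p^k≤q∸2⇒k<n : ∀ k → p ^ k ≤ q ∸ 2 → k < n
    p^k≤q∸2⇒k<n k p^k≤ with k <? n
    ... | yes k<n = k<n
    ... | no k≮n = contradiction (^-monoʳ-≤ p (≮⇒≥ k≮n)) (<⇒≱ (≤-<-trans p^k≤ q∸2<q))

    m*p≤q∸2 : ∀ m → m ≤ a ∸ 1 → m * p ≤ q ∸ 2
    m*p≤q∸2 m m≤a∸1 = subst (_≤ q ∸ 2) (m+n∸n≡m (m * p) 2) (∸-monoˡ-≤ 2 (begin
      m * p + 2   ≤⟨ +-monoʳ-≤ (m * p) 2≤p ⟩
      m * p + p   ≡⟨ +-comm (m * p) p ⟩
      suc m * p   ≤⟨ *-monoˡ-≤ p 1+m≤a ⟩
      a * p       ≡⟨ q≡a*p ⟨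
      q           ∎))
      where
      open ≤-Reasoning
      1+m≤a : suc m ≤ a
      1+m≤a = subst (suc m ≤_) (trans (+-comm 1 (a ∸ 1)) (m∸n+n≡m (m^n>0 p (n ∸ 1)))) (s≤s m≤a∸1)

    m*p≤q∸2⇒ : ∀ m → m * p ≤ q ∸ 2 → m ≤ a ∸ 1
    m*p≤q∸2⇒ m m*p≤ = ∸-monoˡ-≤ 1 (*-cancelʳ-< p m a (subst (m * p <_) q≡a*p (≤-<-trans m*p≤ q∸2<q)))

  module _ {A : Set} {P : A → Set} (P? : ∀ x → Dec (P x)) where
    length-filter-split : ∀ xs → length (filter P? xs) + length (filter (¬? ∘ P?) xs) ≡ length xs
    length-filter-split []       = refl
    length-filter-split (x ∷ xs) with P? x
    ... | yes _ = cong suc (length-filter-split xs)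
    ... | no  _ = trans (+-suc _ _) (cong suc (length-filter-split xs))

  module Counting (p : ℕ) (2≤p : 2 ≤ p) where
    open PowersOf p 2≤p

    rangeℕ-2-snoc : ∀ K → rangeℕ 2 (suc (suc K)) ≡ rangeℕ 2 (suc K) ++ [ K + 2 ]
    rangeℕ-2-snoc K = trans (cong (map (_+ 2)) (sym (upTo-∷ʳ K))) (map-++ (_+ 2) (upTo K) [ K ])

    length-rangeℕ-2 : ∀ K → length (rangeℕ 2 (suc K)) ≡ K
    length-rangeℕ-2 K = trans (length-map (_+ 2) (upTo K)) (length-upTo K)

    #powers : ℕ → ℕ
    #powers K = length (filter isPowerOf? (rangeℕ 2 (suc K)))

    #powers-suc : ∀ K → #powers (suc K) ≡ #powers K + length (filter isPowerOf? [ K + 2 ])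
    #powers-suc K = begin
      length (filter isPowerOf? (rangeℕ 2 (suc (suc K))))
        ≡⟨ cong (length ∘ filter isPowerOf?) (rangeℕ-2-snoc K) ⟩
      length (filter isPowerOf? (rangeℕ 2 (suc K) ++ [ K + 2 ]))
        ≡⟨ cong length (filter-++ isPowerOf? (rangeℕ 2 (suc K)) [ K + 2 ]) ⟩
      length (filter isPowerOf? (rangeℕ 2 (suc K)) ++ filter isPowerOf? [ K + 2 ])
        ≡⟨ length-++ (filter isPowerOf? (rangeℕ 2 (suc K))) ⟩
      #powers K + length (filter isPowerOf? [ K + 2 ])                           ∎
      where open ≡-Reasoning

    #powers≡ : ∀ K j → p ^ j ≤ suc K → suc K < p ^ suc j → #powers K ≡ j
    #powers≡ zero    zero    _ _ = refl
    #powers≡ zero    (suc j) p^j≤1 _ = contradiction p^j≤1 (<⇒≱ (2≤p^1+ j))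
    #powers≡ (suc K) j p^j≤2+K 2+K<p^1+j with isPowerOf? (K + 2)
    ... | no ¬pow = begin
      #powers (suc K)                                      ≡⟨ #powers-suc K ⟩
      #powers K + length (filter isPowerOf? [ K + 2 ])     ≡⟨ cong (#powers K +_) (cong length (filter-reject isPowerOf? ¬pow)) ⟩
      #powers K + 0                                        ≡⟨ +-identityʳ _ ⟩
      #powers K                                            ≡⟨ #powers≡ K j p^j≤1+K (<-trans (n<1+n (suc K)) 2+K<p^1+j) ⟩
      j                                                    ∎
      where
      open ≡-Reasoning
      p^j≤1+K : p ^ j ≤ suc K
      p^j≤1+K with m≤n⇒m<n∨m≡n p^j≤2+K
      ... | inj₁ p^j<2+K = ≤-pred p^j<2+K
      ... | inj₂ p^j≡2+K = contradiction (IsPowerOf⁺ {j} (trans p^j≡2+K (+-comm 2 K))) ¬pow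
    ... | yes pow with IsPowerOf⁻ pow
    ...   | zero  , 1≡K+2     = contradiction (trans 1≡K+2 (+-comm K 2)) λ ()
    ...   | suc i , p^1+i≡K+2 = begin
      #powers (suc K)                                      ≡⟨ #powers-suc K ⟩
      #powers K + length (filter isPowerOf? [ K + 2 ])     ≡⟨ cong (#powers K +_) (cong length (filter-accept isPowerOf? pow)) ⟩
      #powers K + 1                                        ≡⟨ +-comm (#powers K) 1 ⟩
      suc (#powers K)                                      ≡⟨ cong suc (#powers≡ K i p^i≤1+K 1+K<p^1+i) ⟩
      suc i                                                ≡⟨ ^-between-unique p^j≤2+K 2+K<p^1+j p^1+i≡2+K ⟩
      j                                                    ∎
      where
      open ≡-Reasoning
      p^1+i≡2+K : p ^ suc i ≡ suc (suc K)
      p^1+i≡2+K = trans p^1+i≡K+2 (+-comm K 2)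
      p^i≤1+K : p ^ i ≤ suc K
      p^i≤1+K = ≤-pred (subst (p ^ i <_) p^1+i≡2+K (^-monoʳ-< p 2≤p (n<1+n i)))
      1+K<p^1+i : suc K < p ^ suc i
      1+K<p^1+i = subst (suc K <_) (sym p^1+i≡2+K) ≤-refl

    length-nonPowers : ∀ n → 1 ≤ n →
      n + length (filter isNonPowerOf? (rangeℕ 2 (p ^ (n ∸ 1) ∸ 1))) ≡ p ^ (n ∸ 1)
    length-nonPowers (suc zero)      _ = refl
    length-nonPowers (suc (suc n′)) _ with p ^ suc n′ in p^1+n′≡ | 2≤p^1+ n′
    ... | suc zero    | s≤s ()
    ... | suc (suc b) | _ = cong (λ z → suc (suc z)) (begin
      n′ + #nonPowers                 ≡⟨ cong (_+ #nonPowers) (#powers≡ b n′ p^n′≤1+b 1+b<p^1+n′) ⟨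
      #powers b + #nonPowers          ≡⟨ length-filter-split isPowerOf? (rangeℕ 2 (suc b)) ⟩
      length (rangeℕ 2 (suc b))       ≡⟨ length-rangeℕ-2 b ⟩
      b                               ∎)
      where
      open ≡-Reasoning
      #nonPowers = length (filter isNonPowerOf? (rangeℕ 2 (suc b)))
      p^n′≤1+b : p ^ n′ ≤ suc b
      p^n′≤1+b = ≤-pred (subst (p ^ n′ <_) p^1+n′≡ (^-monoʳ-< p 2≤p (n<1+n n′)))
      1+b<p^1+n′ : suc b < p ^ suc n′
      1+b<p^1+n′ = subst (suc b <_) (sym p^1+n′≡) (n<1+n (suc b))

open Arithmetic

module CharacteristicP {c ℓ} (R : CommutativeRing c ℓ) where
  open import Data.Nat.Combinatorics using (_C_; nCn≡1)
  import Data.Nat.GCD as GCD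
  open import Data.Nat.Coprimality using (coprime-Bézout)
  open import Data.Fin as Fin using (Fin; toℕ; fromℕ; inject₁)
  open import Data.Fin.Patterns using (0F)
  open import Data.Fin.Properties using (toℕ<n; toℕ-inject₁; toℕ-fromℕ)
  import Data.Vec.Functional as Vector
  open CommutativeRing R hiding (zero)
  open import Algebra.Properties.Semiring.Mult semiring
  open import Algebra.Properties.Semiring.Exp semiring
  open import Algebra.Properties.Semiring.Sum semiring
  open import Algebra.Properties.CommutativeSemiring.Binomial commutativeSemiring
  open import Relation.Binary.Reasoning.Setoid setoid

  ×-zeroʳ : ∀ n → n × 0# ≈ 0#
  ×-zeroʳ zero    = refl
  ×-zeroʳ (suc n) = trans (+-identityˡ _) (×-zeroʳ n)

  ×≈0-multiple : ∀ {p} m x → p × 1# ≈ 0# → (m ℕ.* p) × x ≈ 0#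
  ×≈0-multiple {p} m x p×1≈0 = begin
    (m ℕ.* p) × x       ≈⟨ ×-assocˡ x m p ⟨
    m × (p × x)         ≈⟨ ×-congʳ m (×-congʳ p (*-identityˡ x)) ⟨
    m × (p × (1# * x))  ≈⟨ ×-congʳ m (×-assoc-* p 1# x) ⟨
    m × ((p × 1#) * x)  ≈⟨ ×-congʳ m (trans (*-congʳ p×1≈0) (zeroˡ x)) ⟩
    m × 0#              ≈⟨ ×-zeroʳ m ⟩
    0#                  ∎

  frobenius : ∀ {p} → Prime p → p × 1# ≈ 0# → ∀ x y → (x + y) ^ p ≈ x ^ p + y ^ p
  frobenius {0} pr = contradiction (prime⇒2≤ pr) λ ()
  frobenius {1} pr = contradiction (prime⇒2≤ pr) λ { (s≤s ()) }
  frobenius {p@(suc (suc m))} pr p×1≈0 x y = begin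
    (x + y) ^ p                                                  ≈⟨ theorem p x y ⟩
    t 0F + sum (Vector.tail t)                                          ≈⟨ +-congˡ (sum-init-last (Vector.tail t)) ⟩
    t 0F + (sum (Vector.init (Vector.tail t)) + t (Fin.suc (fromℕ (suc m)))) ≈⟨ +-cong first (+-cong middle last) ⟩
    y ^ p + (0# + x ^ p)                                         ≈⟨ +-congˡ (+-identityˡ _) ⟩
    y ^ p + x ^ p                                                ≈⟨ +-comm _ _ ⟩
    x ^ p + y ^ p                                                ∎
    where
    t = binomialTerm x y p
    first : t 0F ≈ y ^ p
    first = trans (×-homo-1 _) (*-identityˡ _)
    last-term : ∀ (i : Fin (suc p)) → toℕ i ≡ p → t i ≈ x ^ p
    last-term i i≡p rewrite i≡p =
      trans (×-congˡ (nCn≡1 p)) (trans (×-homo-1 _) (trans (*-congˡ (^-congʳ y (ℕ.n∸n≡0 p))) (*-identityʳ _)))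
    last : t (Fin.suc (fromℕ (suc m))) ≈ x ^ p
    last = last-term _ (≡.cong suc (toℕ-fromℕ (suc m)))
    -- the inner binomial coefficients are divisible by p
    middle-term : ∀ (i : Fin (suc m)) → t (Fin.suc (inject₁ i)) ≈ 0#
    middle-term i with prime∣choose pr (s≤s z≤n) (s≤s (ℕ.≤-trans (s≤s (ℕ.≤-reflexive (toℕ-inject₁ i))) (toℕ<n i)))
    ... | divides k p∣ = trans (×-congˡ p∣) (×≈0-multiple k _ p×1≈0)
    middle : sum (Vector.init (Vector.tail t)) ≈ 0#
    middle = trans (sum-cong-≋ middle-term) (sum-replicate-zero (suc m))

  frobenius-^ : ∀ {p} → Prime p → p × 1# ≈ 0# →
                ∀ j x y → (x + y) ^ (p ℕ.^ j) ≈ x ^ (p ℕ.^ j) + y ^ (p ℕ.^ j)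
  frobenius-^ pr p×1≈0 zero x y =
    trans (*-identityʳ _) (+-cong (sym (*-identityʳ x)) (sym (*-identityʳ y)))
  frobenius-^ {p} pr p×1≈0 (suc j) x y = begin
    (x + y) ^ (p ℕ.* p ℕ.^ j)                 ≈⟨ ^-assocʳ (x + y) p (p ℕ.^ j) ⟨
    ((x + y) ^ p) ^ (p ℕ.^ j)                 ≈⟨ ^-congˡ (p ℕ.^ j) (frobenius pr p×1≈0 x y) ⟩
    (x ^ p + y ^ p) ^ (p ℕ.^ j)               ≈⟨ frobenius-^ pr p×1≈0 j (x ^ p) (y ^ p) ⟩
    (x ^ p) ^ (p ℕ.^ j) + (y ^ p) ^ (p ℕ.^ j) ≈⟨ +-cong (^-assocʳ x p (p ℕ.^ j)) (^-assocʳ y p (p ℕ.^ j)) ⟩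
    x ^ (p ℕ.* p ℕ.^ j) + y ^ (p ℕ.* p ℕ.^ j) ∎

  ×1≈0⇒prime∣ : ¬ 1# ≈ 0# → ∀ {p D} → Prime p → p × 1# ≈ 0# → D × 1# ≈ 0# → p ∣ D
  ×1≈0⇒prime∣ 1≉0 {p} {D} pr p×1≈0 D×1≈0 with p ∣? D
  ... | yes p∣D = p∣D
  ... | no p∤D = contradiction (bézout⇒1≈0 (coprime-Bézout (prime∤⇒coprime pr p∤D))) 1≉0
    where
    1+≡⇒1≈0 : ∀ {a b} → 1 ℕ.+ a ≡ b → a × 1# ≈ 0# → b × 1# ≈ 0# → 1# ≈ 0#
    1+≡⇒1≈0 {a} {b} eq a≈0 b≈0 = begin
      1#               ≈⟨ +-identityʳ 1# ⟨
      1# + 0#          ≈⟨ +-congˡ a≈0 ⟨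
      (1 ℕ.+ a) × 1#   ≡⟨ ≡.cong (_× 1#) eq ⟩
      b × 1#           ≈⟨ b≈0 ⟩
      0#               ∎
    bézout⇒1≈0 : GCD.Bézout.Identity 1 p D → 1# ≈ 0#
    bézout⇒1≈0 (GCD.Bézout.+- x y eq) = 1+≡⇒1≈0 eq (×≈0-multiple y 1# D×1≈0) (×≈0-multiple x 1# p×1≈0)
    bézout⇒1≈0 (GCD.Bézout.-+ x y eq) = 1+≡⇒1≈0 eq (×≈0-multiple x 1# p×1≈0) (×≈0-multiple y 1# D×1≈0)

module Field {c ℓ} (R : CommutativeRing c ℓ) (fld : IsFieldCR R) where
  open import Data.Fin as Fin using (Fin)
  open import Data.Fin.Permutation using (permutation)
  open import Function using (_∘_)
  open CommutativeRing R hiding (zero)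
  open import Algebra.Properties.Semiring.Mult semiring
  open import Algebra.Properties.Semiring.Exp semiring
  open import Algebra.Properties.CommutativeMonoid.Sum +-commutativeMonoid
  open import Relation.Binary.Reasoning.Setoid setoid

  1≉0 : ¬ 1# ≈ 0#
  1≉0 = proj₁ fld

  *-cancelˡ-≈0 : ∀ {x y} → ¬ x ≈ 0# → x * y ≈ 0# → y ≈ 0#
  *-cancelˡ-≈0 {x} {y} x≉0 xy≈0 = begin
    y              ≈⟨ *-identityˡ y ⟨
    1# * y         ≈⟨ *-congʳ (trans (*-comm x′ x) x*x′≈1) ⟨
    (x′ * x) * y   ≈⟨ *-assoc x′ x y ⟩
    x′ * (x * y)   ≈⟨ *-congˡ xy≈0 ⟩
    x′ * 0#        ≈⟨ zeroʳ x′ ⟩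
    0#             ∎
    where
    x′ = proj₁ (proj₂ fld x x≉0)
    x*x′≈1 = proj₂ (proj₂ fld x x≉0)

  ^-nonzero : ∀ {x} → ¬ x ≈ 0# → ∀ n → ¬ x ^ n ≈ 0#
  ^-nonzero x≉0 zero    = 1≉0
  ^-nonzero x≉0 (suc n) = ^-nonzero x≉0 n ∘ *-cancelˡ-≈0 x≉0

  ×1-homo-^ : ∀ m n → (m ℕ.^ n) × 1# ≈ (m × 1#) ^ n
  ×1-homo-^ m zero    = +-identityʳ 1#
  ×1-homo-^ m (suc n) = trans (×1-homo-* m (m ℕ.^ n)) (*-congˡ (×1-homo-^ m n))

  module _ {q} (card : HasCardinality R q) where
    private
      e    = proj₁ card
      inj  = proj₁ (proj₂ card)
      surj = proj₂ (proj₂ card)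

    _≟_ : ∀ x y → Dec (x ≈ y)
    x ≟ y with surj x | surj y
    ... | i , ei≈x | j , ej≈y with i Fin.≟ j
    ... | yes ≡.refl = yes (trans (sym ei≈x) ej≈y)
    ... | no i≢j = no λ x≈y → i≢j (inj i j (trans ei≈x (trans x≈y (sym ej≈y))))

    -- translation by 1 permutes the field, so the sum of all elements S satisfies S = S + q × 1
    card×1≈0 : q × 1# ≈ 0#
    card×1≈0 = +-identityʳ-unique S (q × 1#) (sym (begin
      S                              ≈⟨ ∑-permute e translation ⟩
      sum (λ i → e (+1 1# i))        ≈⟨ sum-cong-≋ (λ i → proj₂ (surj (e i + 1#))) ⟩
      sum (λ i → e i + 1#)           ≈⟨ ∑-distrib-+ e (λ _ → 1#) ⟩
      S + sum (λ (_ : Fin q) → 1#)   ≈⟨ +-congˡ (sum-replicate q) ⟩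
      S + q × 1#                     ∎))
      where
      open import Algebra.Properties.Ring ring using (+-identityʳ-unique)
      S = sum e
      +1 : Carrier → Fin q → Fin q
      +1 a i = proj₁ (surj (e i + a))
      +1-inverse : ∀ {a b} → b + a ≈ 0# → ∀ i → +1 a (+1 b i) ≡ i
      +1-inverse {a} {b} b+a≈0 i = inj _ _ (begin
        e (+1 a (+1 b i))   ≈⟨ proj₂ (surj (e (+1 b i) + a)) ⟩
        e (+1 b i) + a      ≈⟨ +-congʳ (proj₂ (surj (e i + b))) ⟩
        (e i + b) + a       ≈⟨ +-assoc _ _ _ ⟩
        e i + (b + a)       ≈⟨ +-congˡ b+a≈0 ⟩
        e i + 0#            ≈⟨ +-identityʳ _ ⟩
        e i                 ∎)
      translation = permutation (+1 1#) (+1 (- 1#)) (+1-inverse (-‿inverseˡ 1#)) (+1-inverse (-‿inverseʳ 1#))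

  p^n-elements⇒p×1≈0 : ∀ {p n} → HasCardinality R (p ℕ.^ n) → p × 1# ≈ 0#
  p^n-elements⇒p×1≈0 {p} {n} card with _≟_ card (p × 1#) 0#
  ... | yes p×1≈0 = p×1≈0
  ... | no p×1≉0 = contradiction (trans (sym (×1-homo-^ p n)) (card×1≈0 card)) (^-nonzero p×1≉0 n)

module Polynomials {c ℓ} (R : CommutativeRing c ℓ) where
  open import Relation.Binary.Bundles using (Setoid)
  import Relation.Binary.Reasoning.Setoid
  open CommutativeRing R hiding (zero)
  open import Algebra.Properties.Ring ring using (-0#≈0#; -1*x≈-x)
  open import Algebra.Properties.CommutativeSemigroup +-commutativeSemigroup using (interchange; x∙yz≈y∙xz)
  open import Algebra.Properties.CommutativeSemigroup *-commutativeSemigroup using () renaming (x∙yz≈y∙xz to x*yz≈y*xz)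
  open Poly R

  -- a record, so that the two polynomials can be inferred from a proof of f ≋ g
  infix 4 _≋_
  record _≋_ (f g : Pol) : Set ℓ where
    constructor coeffwise
    field at : f ≈P g
  open _≋_ public

  ≋-refl : ∀ {f} → f ≋ f
  ≋-refl = coeffwise λ _ → refl

  ≋-sym : ∀ {f g} → f ≋ g → g ≋ f
  ≋-sym f≋g = coeffwise λ k → sym (at f≋g k)

  ≋-trans : ∀ {f g h} → f ≋ g → g ≋ h → f ≋ h
  ≋-trans f≋g g≋h = coeffwise λ k → trans (at f≋g k) (at g≋h k)

  ≋-setoid : Setoid c ℓ
  ≋-setoid = record
    { Carrier = Pol ; _≈_ = _≋_
    ; isEquivalence = record { refl = ≋-refl ; sym = ≋-sym ; trans = ≋-trans } }

  module ≋-Reasoning = Relation.Binary.Reasoning.Setoid ≋-setoid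

  ∷-cong : ∀ {a b f g} → a ≈ b → f ≋ g → (a ∷ f) ≋ (b ∷ g)
  ∷-cong a≈b f≋g = coeffwise λ { zero → a≈b ; (suc k) → at f≋g k }

  tail-cong : ∀ {a b f g} → (a ∷ f) ≋ (b ∷ g) → f ≋ g
  tail-cong e = coeffwise λ k → at e (suc k)

  tail-≋[] : ∀ {a f} → (a ∷ f) ≋ [] → f ≋ []
  tail-≋[] e = coeffwise λ k → at e (suc k)

  module _ where
    open import Relation.Binary.Reasoning.Setoid setoid

    coeff-+P : ∀ f g k → coeff (f +P g) k ≈ coeff f k + coeff g k
    coeff-+P []      g       k       = sym (+-identityˡ _)
    coeff-+P (a ∷ f) []      k       = sym (+-identityʳ _)
    coeff-+P (a ∷ f) (b ∷ g) zero    = refl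
    coeff-+P (a ∷ f) (b ∷ g) (suc k) = coeff-+P f g k

    coeff-·P : ∀ a f k → coeff (a ·P f) k ≈ a * coeff f k
    coeff-·P a []      k       = sym (zeroʳ a)
    coeff-·P a (b ∷ f) zero    = refl
    coeff-·P a (b ∷ f) (suc k) = coeff-·P a f k

    coeff-negP : ∀ f k → coeff (negP f) k ≈ - coeff f k
    coeff-negP []      k       = sym -0#≈0#
    coeff-negP (b ∷ f) zero    = refl
    coeff-negP (b ∷ f) (suc k) = coeff-negP f k

    +P-cong : ∀ {f f′ g g′} → f ≋ f′ → g ≋ g′ → f +P g ≋ f′ +P g′
    +P-cong {f} {f′} {g} {g′} f≋f′ g≋g′ = coeffwise λ k → begin
      coeff (f +P g) k          ≈⟨ coeff-+P f g k ⟩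
      coeff f k + coeff g k     ≈⟨ +-cong (at f≋f′ k) (at g≋g′ k) ⟩
      coeff f′ k + coeff g′ k   ≈⟨ coeff-+P f′ g′ k ⟨
      coeff (f′ +P g′) k        ∎

    ·P-cong : ∀ {a b f g} → a ≈ b → f ≋ g → a ·P f ≋ b ·P g
    ·P-cong {a} {b} {f} {g} a≈b f≋g = coeffwise λ k → begin
      coeff (a ·P f) k   ≈⟨ coeff-·P a f k ⟩
      a * coeff f k      ≈⟨ *-cong a≈b (at f≋g k) ⟩
      b * coeff g k      ≈⟨ coeff-·P b g k ⟨
      coeff (b ·P g) k   ∎

    negP-cong : ∀ {f g} → f ≋ g → negP f ≋ negP g
    negP-cong {f} {g} f≋g = coeffwise λ k → begin
      coeff (negP f) k   ≈⟨ coeff-negP f k ⟩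
      - coeff f k        ≈⟨ -‿cong (at f≋g k) ⟩
      - coeff g k        ≈⟨ coeff-negP g k ⟨
      coeff (negP g) k   ∎

    shiftX-cong : ∀ {f g} → f ≋ g → shiftX f ≋ shiftX g
    shiftX-cong = ∷-cong refl

    shiftX-≋[] : ∀ {f} → f ≋ [] → shiftX f ≋ []
    shiftX-≋[] f≋[] = coeffwise λ { zero → refl ; (suc k) → at f≋[] k }

    ·P-zeroˡ : ∀ {a} g → a ≈ 0# → a ·P g ≋ []
    ·P-zeroˡ {a} g a≈0 = coeffwise λ k → begin
      coeff (a ·P g) k   ≈⟨ coeff-·P a g k ⟩
      a * coeff g k      ≈⟨ *-congʳ a≈0 ⟩
      0# * coeff g k     ≈⟨ zeroˡ _ ⟩
      0#                 ∎

    ·P-identityˡ : ∀ f → 1# ·P f ≋ f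
    ·P-identityˡ f = coeffwise λ k → trans (coeff-·P 1# f k) (*-identityˡ _)

    +P-assoc : ∀ f g h → (f +P g) +P h ≋ f +P (g +P h)
    +P-assoc f g h = coeffwise λ k → begin
      coeff ((f +P g) +P h) k               ≈⟨ coeff-+P (f +P g) h k ⟩
      coeff (f +P g) k + coeff h k          ≈⟨ +-congʳ (coeff-+P f g k) ⟩
      (coeff f k + coeff g k) + coeff h k   ≈⟨ +-assoc _ _ _ ⟩
      coeff f k + (coeff g k + coeff h k)   ≈⟨ +-congˡ (coeff-+P g h k) ⟨
      coeff f k + coeff (g +P h) k          ≈⟨ coeff-+P f (g +P h) k ⟨
      coeff (f +P (g +P h)) k               ∎

    +P-comm : ∀ f g → f +P g ≋ g +P f
    +P-comm f g = coeffwise λ k → begin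
      coeff (f +P g) k        ≈⟨ coeff-+P f g k ⟩
      coeff f k + coeff g k   ≈⟨ +-comm _ _ ⟩
      coeff g k + coeff f k   ≈⟨ coeff-+P g f k ⟨
      coeff (g +P f) k        ∎

    +P-identityʳ : ∀ f → f +P [] ≋ f
    +P-identityʳ f = coeffwise λ k → trans (coeff-+P f [] k) (+-identityʳ _)

    +P-inverseˡ : ∀ f → negP f +P f ≋ []
    +P-inverseˡ f = coeffwise λ k → begin
      coeff (negP f +P f) k          ≈⟨ coeff-+P (negP f) f k ⟩
      coeff (negP f) k + coeff f k   ≈⟨ +-congʳ (coeff-negP f k) ⟩
      - coeff f k + coeff f k        ≈⟨ -‿inverseˡ _ ⟩
      0#                             ∎

    +P-inverseʳ : ∀ f → f +P negP f ≋ []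
    +P-inverseʳ f = ≋-trans (+P-comm f (negP f)) (+P-inverseˡ f)

    +P-medial : ∀ f g h i → (f +P g) +P (h +P i) ≋ (f +P h) +P (g +P i)
    +P-medial f g h i = coeffwise λ k → begin
      coeff ((f +P g) +P (h +P i)) k                          ≈⟨ coeff-+P (f +P g) (h +P i) k ⟩
      coeff (f +P g) k + coeff (h +P i) k                     ≈⟨ +-cong (coeff-+P f g k) (coeff-+P h i k) ⟩
      (coeff f k + coeff g k) + (coeff h k + coeff i k)       ≈⟨ interchange _ _ _ _ ⟩
      (coeff f k + coeff h k) + (coeff g k + coeff i k)       ≈⟨ +-cong (coeff-+P f h k) (coeff-+P g i k) ⟨
      coeff (f +P h) k + coeff (g +P i) k                     ≈⟨ coeff-+P (f +P h) (g +P i) k ⟨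
      coeff ((f +P h) +P (g +P i)) k                          ∎

    +P-swap : ∀ f g h → f +P (g +P h) ≋ g +P (f +P h)
    +P-swap f g h = coeffwise λ k → begin
      coeff (f +P (g +P h)) k                ≈⟨ coeff-+P f (g +P h) k ⟩
      coeff f k + coeff (g +P h) k           ≈⟨ +-congˡ (coeff-+P g h k) ⟩
      coeff f k + (coeff g k + coeff h k)    ≈⟨ x∙yz≈y∙xz _ _ _ ⟩
      coeff g k + (coeff f k + coeff h k)    ≈⟨ +-congˡ (coeff-+P f h k) ⟨
      coeff g k + coeff (f +P h) k           ≈⟨ coeff-+P g (f +P h) k ⟨
      coeff (g +P (f +P h)) k                ∎

    shiftX-+P : ∀ f g → shiftX (f +P g) ≋ shiftX f +P shiftX g
    shiftX-+P f g = coeffwise λ { zero → sym (+-identityʳ _) ; (suc k) → refl }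

    ·P-distribˡ : ∀ a f g → a ·P (f +P g) ≋ a ·P f +P a ·P g
    ·P-distribˡ a f g = coeffwise λ k → begin
      coeff (a ·P (f +P g)) k                ≈⟨ coeff-·P a (f +P g) k ⟩
      a * coeff (f +P g) k                   ≈⟨ *-congˡ (coeff-+P f g k) ⟩
      a * (coeff f k + coeff g k)            ≈⟨ distribˡ _ _ _ ⟩
      a * coeff f k + a * coeff g k          ≈⟨ +-cong (coeff-·P a f k) (coeff-·P a g k) ⟨
      coeff (a ·P f) k + coeff (a ·P g) k    ≈⟨ coeff-+P (a ·P f) (a ·P g) k ⟨
      coeff (a ·P f +P a ·P g) k             ∎

    ·P-distribʳ : ∀ a b g → (a + b) ·P g ≋ a ·P g +P b ·P g
    ·P-distribʳ a b g = coeffwise λ k → begin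
      coeff ((a + b) ·P g) k                 ≈⟨ coeff-·P (a + b) g k ⟩
      (a + b) * coeff g k                    ≈⟨ distribʳ _ _ _ ⟩
      a * coeff g k + b * coeff g k          ≈⟨ +-cong (coeff-·P a g k) (coeff-·P b g k) ⟨
      coeff (a ·P g) k + coeff (b ·P g) k    ≈⟨ coeff-+P (a ·P g) (b ·P g) k ⟨
      coeff (a ·P g +P b ·P g) k             ∎

    ·P-assoc : ∀ a b g → (a * b) ·P g ≋ a ·P (b ·P g)
    ·P-assoc a b g = coeffwise λ k → begin
      coeff ((a * b) ·P g) k   ≈⟨ coeff-·P (a * b) g k ⟩
      (a * b) * coeff g k      ≈⟨ *-assoc _ _ _ ⟩
      a * (b * coeff g k)      ≈⟨ *-congˡ (coeff-·P b g k) ⟨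
      a * coeff (b ·P g) k     ≈⟨ coeff-·P a (b ·P g) k ⟨
      coeff (a ·P (b ·P g)) k  ∎

    ·P-shiftX : ∀ a f → a ·P shiftX f ≋ shiftX (a ·P f)
    ·P-shiftX a f = coeffwise λ { zero → zeroʳ a ; (suc k) → refl }

    negP≋-1·P : ∀ f → negP f ≋ (- 1#) ·P f
    negP≋-1·P f = coeffwise λ k → begin
      coeff (negP f) k        ≈⟨ coeff-negP f k ⟩
      - coeff f k             ≈⟨ -1*x≈-x _ ⟨
      - 1# * coeff f k        ≈⟨ coeff-·P (- 1#) f k ⟨
      coeff ((- 1#) ·P f) k   ∎

    *P-zeroˡ : ∀ {f} g → f ≋ [] → f *P g ≋ []
    *P-zeroˡ {[]}    g f≋[] = ≋-refl
    *P-zeroˡ {a ∷ f} g f≋[] =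
      +P-cong (·P-zeroˡ g (at f≋[] 0)) (shiftX-≋[] (*P-zeroˡ {f} g (tail-≋[] f≋[])))

    *P-zeroʳ : ∀ f → f *P [] ≋ []
    *P-zeroʳ []      = ≋-refl
    *P-zeroʳ (a ∷ f) = shiftX-≋[] (*P-zeroʳ f)

    *P-congˡ : ∀ {f f′} g → f ≋ f′ → f *P g ≋ f′ *P g
    *P-congˡ {[]}    {[]}      g f≋f′ = ≋-refl
    *P-congˡ {[]}    {a′ ∷ f′} g f≋f′ = ≋-sym (*P-zeroˡ {a′ ∷ f′} g (≋-sym f≋f′))
    *P-congˡ {a ∷ f} {[]}      g f≋f′ = *P-zeroˡ {a ∷ f} g f≋f′
    *P-congˡ {a ∷ f} {a′ ∷ f′} g f≋f′ =
      +P-cong (·P-cong (at f≋f′ 0) ≋-refl) (shiftX-cong (*P-congˡ {f} {f′} g (tail-cong f≋f′)))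

    *P-congʳ : ∀ f {g g′} → g ≋ g′ → f *P g ≋ f *P g′
    *P-congʳ []      g≋g′ = ≋-refl
    *P-congʳ (a ∷ f) g≋g′ = +P-cong (·P-cong refl g≋g′) (shiftX-cong (*P-congʳ f g≋g′))

    *P-cong : ∀ {f f′ g g′} → f ≋ f′ → g ≋ g′ → f *P g ≋ f′ *P g′
    *P-cong {f′ = f′} {g = g} f≋f′ g≋g′ = ≋-trans (*P-congˡ g f≋f′) (*P-congʳ f′ g≋g′)

  *P-identityˡ : ∀ f → oneP *P f ≋ f
  *P-identityˡ f = ≋-trans (+P-cong (·P-identityˡ f) (shiftX-≋[] ≋-refl)) (+P-identityʳ f)

  module _ where
    open ≋-Reasoning

    *P-distribʳ : ∀ f g h → (f +P g) *P h ≋ f *P h +P g *P h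
    *P-distribʳ []      g       h = ≋-refl
    *P-distribʳ (a ∷ f) []      h = ≋-sym (+P-identityʳ ((a ∷ f) *P h))
    *P-distribʳ (a ∷ f) (b ∷ g) h = begin
      (a + b) ·P h +P shiftX ((f +P g) *P h)
        ≈⟨ +P-cong (·P-distribʳ a b h) (shiftX-cong (*P-distribʳ f g h)) ⟩
      (a ·P h +P b ·P h) +P shiftX (f *P h +P g *P h)
        ≈⟨ +P-cong ≋-refl (shiftX-+P (f *P h) (g *P h)) ⟩
      (a ·P h +P b ·P h) +P (shiftX (f *P h) +P shiftX (g *P h))
        ≈⟨ +P-medial (a ·P h) (b ·P h) (shiftX (f *P h)) (shiftX (g *P h)) ⟩
      (a ·P h +P shiftX (f *P h)) +P (b ·P h +P shiftX (g *P h)) ∎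

    *P-distribˡ : ∀ f g h → f *P (g +P h) ≋ f *P g +P f *P h
    *P-distribˡ []      g h = ≋-refl
    *P-distribˡ (a ∷ f) g h = begin
      a ·P (g +P h) +P shiftX (f *P (g +P h))
        ≈⟨ +P-cong (·P-distribˡ a g h) (shiftX-cong (*P-distribˡ f g h)) ⟩
      (a ·P g +P a ·P h) +P shiftX (f *P g +P f *P h)
        ≈⟨ +P-cong ≋-refl (shiftX-+P (f *P g) (f *P h)) ⟩
      (a ·P g +P a ·P h) +P (shiftX (f *P g) +P shiftX (f *P h))
        ≈⟨ +P-medial (a ·P g) (a ·P h) (shiftX (f *P g)) (shiftX (f *P h)) ⟩
      (a ·P g +P shiftX (f *P g)) +P (a ·P h +P shiftX (f *P h)) ∎

    *P-·Pˡ : ∀ a f g → (a ·P f) *P g ≋ a ·P (f *P g)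
    *P-·Pˡ a []      g = ≋-refl
    *P-·Pˡ a (b ∷ f) g = begin
      (a * b) ·P g +P shiftX ((a ·P f) *P g)  ≈⟨ +P-cong (·P-assoc a b g) (shiftX-cong (*P-·Pˡ a f g)) ⟩
      a ·P (b ·P g) +P shiftX (a ·P (f *P g)) ≈⟨ +P-cong ≋-refl (·P-shiftX a (f *P g)) ⟨
      a ·P (b ·P g) +P a ·P shiftX (f *P g)   ≈⟨ ·P-distribˡ a (b ·P g) (shiftX (f *P g)) ⟨
      a ·P (b ·P g +P shiftX (f *P g))        ∎

    shiftX-*P : ∀ f g → shiftX f *P g ≋ shiftX (f *P g)
    shiftX-*P f g = +P-cong (·P-zeroˡ g refl) ≋-refl

    *P-assoc : ∀ f g h → (f *P g) *P h ≋ f *P (g *P h)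
    *P-assoc []      g h = ≋-refl
    *P-assoc (a ∷ f) g h = begin
      (a ·P g +P shiftX (f *P g)) *P h          ≈⟨ *P-distribʳ (a ·P g) (shiftX (f *P g)) h ⟩
      (a ·P g) *P h +P shiftX (f *P g) *P h     ≈⟨ +P-cong (*P-·Pˡ a g h) (shiftX-*P (f *P g) h) ⟩
      a ·P (g *P h) +P shiftX ((f *P g) *P h)   ≈⟨ +P-cong ≋-refl (shiftX-cong (*P-assoc f g h)) ⟩
      a ·P (g *P h) +P shiftX (f *P (g *P h))   ∎

    *P-∷ʳ : ∀ f b g → f *P (b ∷ g) ≋ b ·P f +P shiftX (f *P g)
    *P-∷ʳ []      b g = coeffwise λ { zero → refl ; (suc k) → refl }
    *P-∷ʳ (a ∷ f) b g = ∷-cong (+-congʳ (*-comm a b)) (begin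
      a ·P g +P f *P (b ∷ g)                  ≈⟨ +P-cong ≋-refl (*P-∷ʳ f b g) ⟩
      a ·P g +P (b ·P f +P shiftX (f *P g))   ≈⟨ +P-swap (a ·P g) (b ·P f) (shiftX (f *P g)) ⟩
      b ·P f +P (a ·P g +P shiftX (f *P g))   ∎)

    *P-comm : ∀ f g → f *P g ≋ g *P f
    *P-comm []      g = ≋-sym (*P-zeroʳ g)
    *P-comm (a ∷ f) g = begin
      a ·P g +P shiftX (f *P g) ≈⟨ +P-cong ≋-refl (shiftX-cong (*P-comm f g)) ⟩
      a ·P g +P shiftX (g *P f) ≈⟨ *P-∷ʳ g a f ⟨
      g *P (a ∷ f)              ∎

  polyRing : CommutativeRing c ℓ
  polyRing = record
    { Carrier = Pol ; _≈_ = _≋_ ; _+_ = _+P_ ; _*_ = _*P_ ; -_ = negP ; 0# = [] ; 1# = oneP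
    ; isCommutativeRing = record
      { isRing = record
        { +-isAbelianGroup = record
          { isGroup = record
            { isMonoid = record
              { isSemigroup = record
                { isMagma = record { isEquivalence = Setoid.isEquivalence ≋-setoid ; ∙-cong = +P-cong }
                ; assoc = +P-assoc }
              ; identity = (λ _ → ≋-refl) , +P-identityʳ }
            ; inverse = +P-inverseˡ , +P-inverseʳ
            ; ⁻¹-cong = negP-cong }
          ; comm = +P-comm }
        ; *-cong = *P-cong
        ; *-assoc = *P-assoc
        ; *-identity = *P-identityˡ , (λ f → ≋-trans (*P-comm f oneP) (*P-identityˡ f))
        ; distrib = *P-distribˡ , (λ f g h → *P-distribʳ g h f) }
      ; *-comm = *P-comm } }

  module _ where
    open ≋-Reasoning

    *P-·Pʳ : ∀ a f g → f *P (a ·P g) ≋ a ·P (f *P g)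
    *P-·Pʳ a f g = begin
      f *P (a ·P g)   ≈⟨ *P-comm f (a ·P g) ⟩
      (a ·P g) *P f   ≈⟨ *P-·Pˡ a g f ⟩
      a ·P (g *P f)   ≈⟨ ·P-cong refl (*P-comm g f) ⟩
      a ·P (f *P g)   ∎

    const-cong : ∀ {a b} → a ≈ b → const a ≋ const b
    const-cong a≈b = ∷-cong a≈b ≋-refl

    const-≋[] : ∀ {a} → a ≈ 0# → const a ≋ []
    const-≋[] a≈0 = coeffwise λ { zero → a≈0 ; (suc k) → refl }

    const-*P : ∀ a f → const a *P f ≋ a ·P f
    const-*P a f = ≋-trans (+P-cong ≋-refl (shiftX-≋[] ≋-refl)) (+P-identityʳ (a ·P f))

    ^P-cong : ∀ {f g} k → f ≋ g → f ^P k ≋ g ^P k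
    ^P-cong zero    f≋g = ≋-refl
    ^P-cong (suc k) f≋g = *P-cong f≋g (^P-cong k f≋g)

    compose-≋[] : ∀ {f} g → f ≋ [] → compose f g ≋ []
    compose-≋[] {[]}    g f≋[] = ≋-refl
    compose-≋[] {a ∷ f} g f≋[] = begin
      const a +P g *P compose f g ≈⟨ +P-cong (const-≋[] (at f≋[] 0)) (*P-congʳ g (compose-≋[] {f} g (tail-≋[] f≋[]))) ⟩
      [] +P g *P []               ≈⟨ *P-zeroʳ g ⟩
      []                          ∎

    compose-congˡ : ∀ {f f′} g → f ≋ f′ → compose f g ≋ compose f′ g
    compose-congˡ {[]}    {[]}      g f≋f′ = ≋-refl
    compose-congˡ {[]}    {a′ ∷ f′} g f≋f′ = ≋-sym (compose-≋[] {a′ ∷ f′} g (≋-sym f≋f′))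
    compose-congˡ {a ∷ f} {[]}      g f≋f′ = compose-≋[] {a ∷ f} g f≋f′
    compose-congˡ {a ∷ f} {a′ ∷ f′} g f≋f′ =
      +P-cong (const-cong (at f≋f′ 0)) (*P-congʳ g (compose-congˡ {f} {f′} g (tail-cong f≋f′)))

    compose-+P : ∀ f h g → compose (f +P h) g ≋ compose f g +P compose h g
    compose-+P []      h       g = ≋-refl
    compose-+P (a ∷ f) []      g = ≋-sym (+P-identityʳ (compose (a ∷ f) g))
    compose-+P (a ∷ f) (b ∷ h) g = begin
      const (a + b) +P g *P compose (f +P h) g
        ≈⟨ +P-cong ≋-refl (*P-congʳ g (compose-+P f h g)) ⟩
      (const a +P const b) +P g *P (compose f g +P compose h g)
        ≈⟨ +P-cong ≋-refl (*P-distribˡ g (compose f g) (compose h g)) ⟩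
      (const a +P const b) +P (g *P compose f g +P g *P compose h g)
        ≈⟨ +P-medial (const a) (const b) (g *P compose f g) (g *P compose h g) ⟩
      (const a +P g *P compose f g) +P (const b +P g *P compose h g) ∎

    compose-·P : ∀ a f g → compose (a ·P f) g ≋ a ·P compose f g
    compose-·P a []      g = ≋-refl
    compose-·P a (b ∷ f) g = begin
      const (a * b) +P g *P compose (a ·P f) g ≈⟨ +P-cong ≋-refl (*P-congʳ g (compose-·P a f g)) ⟩
      a ·P const b +P g *P (a ·P compose f g)  ≈⟨ +P-cong ≋-refl (*P-·Pʳ a g (compose f g)) ⟩
      a ·P const b +P a ·P (g *P compose f g)  ≈⟨ ·P-distribˡ a (const b) (g *P compose f g) ⟨
      a ·P (const b +P g *P compose f g)       ∎

    compose-negP : ∀ f g → compose (negP f) g ≋ negP (compose f g)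
    compose-negP f g = begin
      compose (negP f) g        ≈⟨ compose-congˡ g (negP≋-1·P f) ⟩
      compose ((- 1#) ·P f) g   ≈⟨ compose-·P (- 1#) f g ⟩
      (- 1#) ·P compose f g     ≈⟨ negP≋-1·P (compose f g) ⟨
      negP (compose f g)        ∎

    compose-shiftX : ∀ f g → compose (shiftX f) g ≋ g *P compose f g
    compose-shiftX f g = +P-cong (const-≋[] refl) ≋-refl

    compose-*P : ∀ f h g → compose (f *P h) g ≋ compose f g *P compose h g
    compose-*P []      h g = ≋-refl
    compose-*P (a ∷ f) h g = begin
      compose (a ·P h +P shiftX (f *P h)) g
        ≈⟨ compose-+P (a ·P h) (shiftX (f *P h)) g ⟩
      compose (a ·P h) g +P compose (shiftX (f *P h)) g
        ≈⟨ +P-cong (compose-·P a h g) (compose-shiftX (f *P h) g) ⟩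
      a ·P compose h g +P g *P compose (f *P h) g
        ≈⟨ +P-cong ≋-refl (*P-congʳ g (compose-*P f h g)) ⟩
      a ·P compose h g +P g *P (compose f g *P compose h g)
        ≈⟨ +P-cong (const-*P a (compose h g)) (*P-assoc g (compose f g) (compose h g)) ⟨
      const a *P compose h g +P (g *P compose f g) *P compose h g
        ≈⟨ *P-distribʳ (const a) (g *P compose f g) (compose h g) ⟨
      (const a +P g *P compose f g) *P compose h g ∎

    compose-oneP : ∀ g → compose oneP g ≋ oneP
    compose-oneP g = +P-cong ≋-refl (*P-zeroʳ g)

    compose-X : ∀ g → compose X g ≋ g
    compose-X g = begin
      const 0# +P g *P compose oneP g ≈⟨ +P-cong (const-≋[] refl) (*P-congʳ g (compose-oneP g)) ⟩
      g *P oneP                       ≈⟨ *P-comm g oneP ⟩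
      oneP *P g                       ≈⟨ *P-identityˡ g ⟩
      g                               ∎

    compose-^P : ∀ f k g → compose (f ^P k) g ≋ compose f g ^P k
    compose-^P f zero    g = compose-oneP g
    compose-^P f (suc k) g = ≋-trans (compose-*P f (f ^P k) g) (*P-congʳ (compose f g) (compose-^P f k g))

    compose-mono : ∀ k g → compose (mono k) g ≋ g ^P k
    compose-mono k g = ≋-trans (compose-^P X k g) (^P-cong k (compose-X g))

  module _ where
    open import Relation.Binary.Reasoning.Setoid setoid

    eval-≋[] : ∀ {f} t → f ≋ [] → eval f t ≈ 0#
    eval-≋[] {[]}    t f≋[] = refl
    eval-≋[] {a ∷ f} t f≋[] = begin
      a + t * eval f t   ≈⟨ +-cong (at f≋[] 0) (*-congˡ (eval-≋[] {f} t (tail-≋[] f≋[]))) ⟩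
      0# + t * 0#        ≈⟨ +-identityˡ _ ⟩
      t * 0#             ≈⟨ zeroʳ t ⟩
      0#                 ∎

    eval-cong : ∀ {f f′} t → f ≋ f′ → eval f t ≈ eval f′ t
    eval-cong {[]}    {[]}      t f≋f′ = refl
    eval-cong {[]}    {a′ ∷ f′} t f≋f′ = sym (eval-≋[] {a′ ∷ f′} t (≋-sym f≋f′))
    eval-cong {a ∷ f} {[]}      t f≋f′ = eval-≋[] {a ∷ f} t f≋f′
    eval-cong {a ∷ f} {a′ ∷ f′} t f≋f′ = +-cong (at f≋f′ 0) (*-congˡ (eval-cong {f} {f′} t (tail-cong f≋f′)))

    eval-+P : ∀ f g t → eval (f +P g) t ≈ eval f t + eval g t
    eval-+P []      g       t = sym (+-identityˡ _)
    eval-+P (a ∷ f) []      t = sym (+-identityʳ _)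
    eval-+P (a ∷ f) (b ∷ g) t = begin
      (a + b) + t * eval (f +P g) t                   ≈⟨ +-congˡ (*-congˡ (eval-+P f g t)) ⟩
      (a + b) + t * (eval f t + eval g t)             ≈⟨ +-congˡ (distribˡ t _ _) ⟩
      (a + b) + (t * eval f t + t * eval g t)         ≈⟨ interchange a b _ _ ⟩
      (a + t * eval f t) + (b + t * eval g t)         ∎

    eval-·P : ∀ a f t → eval (a ·P f) t ≈ a * eval f t
    eval-·P a []      t = sym (zeroʳ a)
    eval-·P a (b ∷ f) t = begin
      a * b + t * eval (a ·P f) t   ≈⟨ +-congˡ (*-congˡ (eval-·P a f t)) ⟩
      a * b + t * (a * eval f t)    ≈⟨ +-congˡ (x*yz≈y*xz t a _) ⟩
      a * b + a * (t * eval f t)    ≈⟨ distribˡ a b _ ⟨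
      a * (b + t * eval f t)        ∎

    eval-*P : ∀ f g t → eval (f *P g) t ≈ eval f t * eval g t
    eval-*P []      g t = sym (zeroˡ _)
    eval-*P (a ∷ f) g t = begin
      eval (a ·P g +P shiftX (f *P g)) t                 ≈⟨ eval-+P (a ·P g) (shiftX (f *P g)) t ⟩
      eval (a ·P g) t + (0# + t * eval (f *P g) t)       ≈⟨ +-cong (eval-·P a g t) (+-identityˡ _) ⟩
      a * eval g t + t * eval (f *P g) t                 ≈⟨ +-congˡ (*-congˡ (eval-*P f g t)) ⟩
      a * eval g t + t * (eval f t * eval g t)           ≈⟨ +-congˡ (*-assoc _ _ _) ⟨
      a * eval g t + (t * eval f t) * eval g t           ≈⟨ distribʳ _ _ _ ⟨
      (a + t * eval f t) * eval g t                      ∎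

    eval-negP : ∀ f t → eval (negP f) t ≈ - eval f t
    eval-negP f t = begin
      eval (negP f) t          ≈⟨ eval-cong t (negP≋-1·P f) ⟩
      eval ((- 1#) ·P f) t     ≈⟨ eval-·P (- 1#) f t ⟩
      - 1# * eval f t          ≈⟨ -1*x≈-x _ ⟩
      - eval f t               ∎

    eval-oneP : ∀ t → eval oneP t ≈ 1#
    eval-oneP t = trans (+-congˡ (zeroʳ t)) (+-identityʳ _)

    eval-X-1 : eval X 1# ≈ 1#
    eval-X-1 = trans (+-identityˡ _) (trans (*-identityˡ _) (eval-oneP 1#))

    eval-mono-1 : ∀ k → eval (mono k) 1# ≈ 1#
    eval-mono-1 zero    = eval-oneP 1#
    eval-mono-1 (suc k) = begin
      eval (X *P mono k) 1#            ≈⟨ eval-*P X (mono k) 1# ⟩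
      eval X 1# * eval (mono k) 1#     ≈⟨ *-cong eval-X-1 (eval-mono-1 k) ⟩
      1# * 1#                          ≈⟨ *-identityˡ _ ⟩
      1#                               ∎

module Degrees {c ℓ} (R : CommutativeRing c ℓ) where
  open CommutativeRing R hiding (zero)
  open import Algebra.Properties.Ring ring using (-0#≈0#)
  open import Algebra.Properties.Semiring.Mult semiring using (_×_)
  open import Algebra.Properties.CommutativeSemigroup +-commutativeSemigroup using (x∙yz≈y∙xz)
  open import Data.Product using () renaming (_×_ to _∧_)
  open Poly R
  open Polynomials R
  open import Relation.Binary.Reasoning.Setoid setoid

  Deg≤ : Pol → ℕ → Set ℓ
  Deg≤ f d = ∀ k → d ℕ.< k → coeff f k ≈ 0#

  MonicOfDegree : Pol → ℕ → Set ℓ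
  MonicOfDegree f d = Deg≤ f d ∧ coeff f d ≈ 1#

  Deg≤-weaken : ∀ {f d d′} → d ℕ.≤ d′ → Deg≤ f d → Deg≤ f d′
  Deg≤-weaken d≤d′ f≤d k d′<k = f≤d k (ℕ.≤-<-trans d≤d′ d′<k)

  Deg≤-+P : ∀ {f g d} → Deg≤ f d → Deg≤ g d → Deg≤ (f +P g) d
  Deg≤-+P {f} {g} f≤d g≤d k d<k = trans (coeff-+P f g k) (trans (+-cong (f≤d k d<k) (g≤d k d<k)) (+-identityˡ _))

  Deg≤-negP : ∀ {f d} → Deg≤ f d → Deg≤ (negP f) d
  Deg≤-negP {f} f≤d k d<k = trans (coeff-negP f k) (trans (-‿cong (f≤d k d<k)) -0#≈0#)

  Deg≤-·P : ∀ {f d} a → Deg≤ f d → Deg≤ (a ·P f) d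
  Deg≤-·P {f} a f≤d k d<k = trans (coeff-·P a f k) (trans (*-congˡ (f≤d k d<k)) (zeroʳ a))

  Deg≤-lower : ∀ {f d} → Deg≤ f (suc d) → coeff f (suc d) ≈ 0# → Deg≤ f d
  Deg≤-lower f≤1+d top≈0 k d<k with ℕ.m≤n⇒m<n∨m≡n d<k
  ... | inj₁ 1+d<k  = f≤1+d k 1+d<k
  ... | inj₂ ≡.refl = top≈0

  coeff-subtract-·P : ∀ f a g k → coeff (f -P a ·P g) k ≈ coeff f k - a * coeff g k
  coeff-subtract-·P f a g k =
    trans (coeff-+P f (negP (a ·P g)) k) (+-congˡ (trans (coeff-negP (a ·P g) k) (-‿cong (coeff-·P a g k))))

  Deg≤-cancel-top : ∀ f g d → Deg≤ f (suc d) → MonicOfDegree g (suc d) → Deg≤ (f -P coeff f (suc d) ·P g) d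
  Deg≤-cancel-top f g d f≤1+d (g≤1+d , g-top≈1) =
    Deg≤-lower {f -P lc ·P g} (Deg≤-+P {f} {negP (lc ·P g)} f≤1+d (Deg≤-negP {lc ·P g} (Deg≤-·P {g} lc g≤1+d))) top≈0
    where
    lc = coeff f (suc d)
    top≈0 : coeff (f -P lc ·P g) (suc d) ≈ 0#
    top≈0 = begin
      coeff (f -P lc ·P g) (suc d)   ≈⟨ coeff-subtract-·P f lc g (suc d) ⟩
      lc - lc * coeff g (suc d)      ≈⟨ +-congˡ (-‿cong (trans (*-congˡ g-top≈1) (*-identityʳ lc))) ⟩
      lc - lc                        ≈⟨ -‿inverseʳ lc ⟩
      0#                             ∎

  Deg≤-tail : ∀ {a f d} → Deg≤ (a ∷ f) (suc d) → Deg≤ f d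
  Deg≤-tail f≤1+d k d<k = f≤1+d (suc k) (s≤s d<k)

  Deg≤0⇒tail≋[] : ∀ {a f} → Deg≤ (a ∷ f) 0 → f ≋ []
  Deg≤0⇒tail≋[] f≤0 = coeffwise λ k → f≤0 (suc k) (s≤s z≤n)

  coeff-∷-*P : ∀ a f g k → coeff ((a ∷ f) *P g) k ≈ a * coeff g k + coeff (shiftX (f *P g)) k
  coeff-∷-*P a f g k = trans (coeff-+P (a ·P g) (shiftX (f *P g)) k) (+-congʳ (coeff-·P a g k))

  Deg≤-*P : ∀ f g m n → Deg≤ f m → Deg≤ g n →
            Deg≤ (f *P g) (m ℕ.+ n) ∧ coeff (f *P g) (m ℕ.+ n) ≈ coeff f m * coeff g n
  Deg≤-*P []      g m n f≤m g≤n = (λ _ _ → refl) , sym (zeroˡ _)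
  Deg≤-*P (a ∷ f) g zero n f≤m g≤n = deg , top
    where
    tail≈0 : ∀ k → coeff (shiftX (f *P g)) k ≈ 0#
    tail≈0 = at (shiftX-≋[] (*P-zeroˡ g (Deg≤0⇒tail≋[] f≤m)))
    deg : Deg≤ ((a ∷ f) *P g) n
    deg k n<k = begin
      coeff ((a ∷ f) *P g) k                     ≈⟨ coeff-∷-*P a f g k ⟩
      a * coeff g k + coeff (shiftX (f *P g)) k  ≈⟨ +-cong (*-congˡ (g≤n k n<k)) (tail≈0 k) ⟩
      a * 0# + 0#                                ≈⟨ trans (+-identityʳ _) (zeroʳ a) ⟩
      0#                                         ∎
    top : coeff ((a ∷ f) *P g) n ≈ a * coeff g n
    top = trans (coeff-∷-*P a f g n) (trans (+-congˡ (tail≈0 n)) (+-identityʳ _))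
  Deg≤-*P (a ∷ f) g (suc m) n f≤m g≤n = deg , top
    where
    ih = Deg≤-*P f g m n (Deg≤-tail f≤m) g≤n
    deg : Deg≤ ((a ∷ f) *P g) (suc m ℕ.+ n)
    deg (suc k) (s≤s m+n<k) = begin
      coeff ((a ∷ f) *P g) (suc k)       ≈⟨ coeff-∷-*P a f g (suc k) ⟩
      a * coeff g (suc k) + coeff (f *P g) k
        ≈⟨ +-cong (*-congˡ (g≤n (suc k) (s≤s (ℕ.≤-trans (ℕ.m≤n+m n m) (ℕ.<⇒≤ m+n<k))))) (proj₁ ih k m+n<k) ⟩
      a * 0# + 0#                        ≈⟨ trans (+-identityʳ _) (zeroʳ a) ⟩
      0#                                 ∎
    top : coeff ((a ∷ f) *P g) (suc m ℕ.+ n) ≈ coeff f m * coeff g n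
    top = begin
      coeff ((a ∷ f) *P g) (suc (m ℕ.+ n))         ≈⟨ coeff-∷-*P a f g (suc (m ℕ.+ n)) ⟩
      a * coeff g (suc (m ℕ.+ n)) + coeff (f *P g) (m ℕ.+ n)
        ≈⟨ +-cong (*-congˡ (g≤n (suc (m ℕ.+ n)) (s≤s (ℕ.m≤n+m n m)))) (proj₂ ih) ⟩
      a * 0# + coeff f m * coeff g n               ≈⟨ trans (+-congʳ (zeroʳ a)) (+-identityˡ _) ⟩
      coeff f m * coeff g n                        ∎

  coeff-*P-0 : ∀ f g → coeff (f *P g) 0 ≈ coeff f 0 * coeff g 0
  coeff-*P-0 []      g = sym (zeroˡ _)
  coeff-*P-0 (a ∷ f) g = trans (coeff-∷-*P a f g 0) (+-identityʳ _)

  coeff-^P-0 : ∀ f m → coeff f 0 ≈ 0# → coeff (f ^P suc m) 0 ≈ 0#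
  coeff-^P-0 f m f0≈0 = trans (coeff-*P-0 f (f ^P m)) (trans (*-congʳ f0≈0) (zeroˡ _))

  MonicOfDegree-*P : ∀ f g {m n} → MonicOfDegree f m → MonicOfDegree g n → MonicOfDegree (f *P g) (m ℕ.+ n)
  MonicOfDegree-*P f g {m} {n} (f≤m , fm≈1) (g≤n , gn≈1) =
    proj₁ fg , trans (proj₂ fg) (trans (*-cong fm≈1 gn≈1) (*-identityˡ _))
    where fg = Deg≤-*P f g m n f≤m g≤n

  MonicOfDegree-^P : ∀ f {d} m → MonicOfDegree f d → MonicOfDegree (f ^P m) (m ℕ.* d)
  MonicOfDegree-^P f zero    f-monic = (λ { (suc k) _ → refl }) , refl
  MonicOfDegree-^P f (suc m) f-monic = MonicOfDegree-*P f (f ^P m) f-monic (MonicOfDegree-^P f m f-monic)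

  MonicOfDegree-X : MonicOfDegree X 1
  MonicOfDegree-X = (λ { (suc (suc k)) _ → refl ; (suc zero) (s≤s ()) }) , refl

  MonicOfDegree-mono : ∀ k → MonicOfDegree (mono k) k
  MonicOfDegree-mono k = ≡.subst (MonicOfDegree (mono k)) (ℕ.*-identityʳ k) (MonicOfDegree-^P X k MonicOfDegree-X)

  X+1-*P : ∀ h → (X +P oneP) *P h ≋ h +P shiftX h
  X+1-*P h = +P-cong (≋-trans (·P-cong (+-identityˡ 1#) ≋-refl) (·P-identityˡ h)) (shiftX-cong (*P-identityˡ h))

  shift1-∷ : ∀ a g → shift1 (a ∷ g) ≋ const a +P (shift1 g +P shiftX (shift1 g))
  shift1-∷ a g = +P-cong (≋-refl {const a}) (X+1-*P (shift1 g))

  coeff-shift1-∷-suc : ∀ a g k → coeff (shift1 (a ∷ g)) (suc k) ≈ coeff (shift1 g) (suc k) + coeff (shift1 g) k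
  coeff-shift1-∷-suc a g k = begin
    coeff (shift1 (a ∷ g)) (suc k)                                  ≈⟨ at (shift1-∷ a g) (suc k) ⟩
    coeff (const a +P (shift1 g +P shiftX (shift1 g))) (suc k)      ≈⟨ coeff-+P (const a) (shift1 g +P shiftX (shift1 g)) (suc k) ⟩
    0# + coeff (shift1 g +P shiftX (shift1 g)) (suc k)              ≈⟨ +-identityˡ _ ⟩
    coeff (shift1 g +P shiftX (shift1 g)) (suc k)                   ≈⟨ coeff-+P (shift1 g) (shiftX (shift1 g)) (suc k) ⟩
    coeff (shift1 g) (suc k) + coeff (shift1 g) k                   ∎

  coeff-shift1-∷-0 : ∀ a g → coeff (shift1 (a ∷ g)) 0 ≈ a + coeff (shift1 g) 0
  coeff-shift1-∷-0 a g = begin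
    coeff (shift1 (a ∷ g)) 0                                        ≈⟨ at (shift1-∷ a g) 0 ⟩
    coeff (const a +P (shift1 g +P shiftX (shift1 g))) 0            ≈⟨ coeff-+P (const a) (shift1 g +P shiftX (shift1 g)) 0 ⟩
    a + coeff (shift1 g +P shiftX (shift1 g)) 0                     ≈⟨ +-congˡ (coeff-+P (shift1 g) (shiftX (shift1 g)) 0) ⟩
    a + (coeff (shift1 g) 0 + 0#)                                   ≈⟨ +-congˡ (+-identityʳ _) ⟩
    a + coeff (shift1 g) 0                                          ∎

  shift1-Deg≤ : ∀ g d → Deg≤ g d → Deg≤ (shift1 g) d ∧ coeff (shift1 g) d ≈ coeff g d
  shift1-Deg≤ []      d       g≤d = (λ _ _ → refl) , refl
  shift1-Deg≤ (a ∷ g) zero    g≤0 = deg , top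
    where
    tail≈0 : ∀ k → coeff (shift1 g) k ≈ 0#
    tail≈0 = at (compose-≋[] (X +P oneP) (Deg≤0⇒tail≋[] g≤0))
    deg : Deg≤ (shift1 (a ∷ g)) 0
    deg (suc k) _ = trans (coeff-shift1-∷-suc a g k) (trans (+-cong (tail≈0 (suc k)) (tail≈0 k)) (+-identityˡ _))
    top = trans (coeff-shift1-∷-0 a g) (trans (+-congˡ (tail≈0 0)) (+-identityʳ a))
  shift1-Deg≤ (a ∷ g) (suc d) g≤1+d = deg , top
    where
    ih = shift1-Deg≤ g d (Deg≤-tail g≤1+d)
    deg : Deg≤ (shift1 (a ∷ g)) (suc d)
    deg (suc k) (s≤s d<k) = trans (coeff-shift1-∷-suc a g k)
      (trans (+-cong (proj₁ ih (suc k) (ℕ.m<n⇒m<1+n d<k)) (proj₁ ih k d<k)) (+-identityˡ _))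
    top = trans (coeff-shift1-∷-suc a g d) (trans (+-cong (proj₁ ih (suc d) (ℕ.n<1+n d)) (proj₂ ih)) (+-identityˡ _))

  -- (x + 1)^(d+1) contributes (d + 1) x^d
  coeff-shift1-subleading : ∀ g d → Deg≤ g (suc d) → coeff (shift1 g) d ≈ coeff g d + suc d × coeff g (suc d)
  coeff-shift1-subleading []      d       g≤1+d = sym (trans (+-identityˡ _) (×-zeroʳ (suc d)))
    where open CharacteristicP R using (×-zeroʳ)
  coeff-shift1-subleading (a ∷ g) zero    g≤1 =
    trans (coeff-shift1-∷-0 a g) (+-congˡ (trans (proj₂ (shift1-Deg≤ g 0 (Deg≤-tail g≤1))) (sym (+-identityʳ _))))
  coeff-shift1-subleading (a ∷ g) (suc d) g≤2+d = begin
    coeff (shift1 (a ∷ g)) (suc d)                            ≈⟨ coeff-shift1-∷-suc a g d ⟩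
    coeff (shift1 g) (suc d) + coeff (shift1 g) d
      ≈⟨ +-cong (proj₂ (shift1-Deg≤ g (suc d) (Deg≤-tail g≤2+d))) (coeff-shift1-subleading g d (Deg≤-tail g≤2+d)) ⟩
    coeff g (suc d) + (coeff g d + suc d × coeff g (suc d))   ≈⟨ x∙yz≈y∙xz _ _ _ ⟩
    coeff g d + (coeff g (suc d) + suc d × coeff g (suc d))   ∎

module FixedPoints {c ℓ} (R : CommutativeRing c ℓ) where
  open CommutativeRing R hiding (zero)
  open import Algebra.Properties.Ring ring using (-‿distribʳ-*)
  open import Algebra.Properties.Semiring.Mult semiring using (_×_)
  open Poly R
  open Polynomials R
  open Degrees R
  open import Algebra.Properties.Ring (CommutativeRing.ring polyRing) using () renaming (-‿+-comm to negP-+P-comm)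

  Fixed : Pol → Set ℓ
  Fixed f = Amap f ≋ f

  Amap-cong : ∀ {f g} → f ≋ g → Amap f ≋ Amap g
  Amap-cong f≋g = +P-cong (compose-congˡ (X +P oneP) f≋g) (negP-cong (const-cong (eval-cong 1# f≋g)))

  Fixed-resp-≋ : ∀ {f g} → f ≋ g → Fixed f → Fixed g
  Fixed-resp-≋ f≋g f-fixed = ≋-trans (≋-sym (Amap-cong f≋g)) (≋-trans f-fixed f≋g)

  Amap-+P : ∀ f g → Amap (f +P g) ≋ Amap f +P Amap g
  Amap-+P f g = begin
    shift1 (f +P g) +P negP (const (eval (f +P g) 1#))
      ≈⟨ +P-cong (compose-+P f g (X +P oneP)) (negP-cong (const-cong (eval-+P f g 1#))) ⟩
    (shift1 f +P shift1 g) +P negP (const (eval f 1#) +P const (eval g 1#))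
      ≈⟨ +P-cong ≋-refl (negP-+P-comm (const (eval f 1#)) (const (eval g 1#))) ⟨
    (shift1 f +P shift1 g) +P (negP (const (eval f 1#)) +P negP (const (eval g 1#)))
      ≈⟨ +P-medial (shift1 f) (shift1 g) (negP (const (eval f 1#))) (negP (const (eval g 1#))) ⟩
    Amap f +P Amap g ∎
    where open ≋-Reasoning

  ·P-negP : ∀ a f → a ·P negP f ≋ negP (a ·P f)
  ·P-negP a f = coeffwise λ k → trans (coeff-·P a (negP f) k) (trans (*-congˡ (coeff-negP f k))
                  (trans (sym (-‿distribʳ-* a (coeff f k))) (trans (-‿cong (sym (coeff-·P a f k))) (sym (coeff-negP (a ·P f) k)))))

  Amap-·P : ∀ a f → Amap (a ·P f) ≋ a ·P Amap f
  Amap-·P a f = begin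
    shift1 (a ·P f) +P negP (const (eval (a ·P f) 1#))
      ≈⟨ +P-cong (compose-·P a f (X +P oneP)) (negP-cong (const-cong (eval-·P a f 1#))) ⟩
    a ·P shift1 f +P negP (a ·P const (eval f 1#))
      ≈⟨ +P-cong ≋-refl (·P-negP a (const (eval f 1#))) ⟨
    a ·P shift1 f +P a ·P negP (const (eval f 1#))
      ≈⟨ ·P-distribˡ a (shift1 f) (negP (const (eval f 1#))) ⟨
    a ·P Amap f ∎
    where open ≋-Reasoning

  Fixed-+P : ∀ {f g} → Fixed f → Fixed g → Fixed (f +P g)
  Fixed-+P {f} {g} f-fixed g-fixed = ≋-trans (Amap-+P f g) (+P-cong f-fixed g-fixed)

  Fixed-·P : ∀ {f} a → Fixed f → Fixed (a ·P f)
  Fixed-·P {f} a f-fixed = ≋-trans (Amap-·P a f) (·P-cong refl f-fixed)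

  Fixed-negP : ∀ {f} → Fixed f → Fixed (negP f)
  Fixed-negP {f} f-fixed = Fixed-resp-≋ (≋-sym (negP≋-1·P f)) (Fixed-·P (- 1#) f-fixed)

  module _ {p} (pr : Prime p) (p×1≈0 : p × 1# ≈ 0#) where
    open CharacteristicP R using (×-zeroʳ)
    module PR = CommutativeRing polyRing
    open import Algebra.Properties.Semiring.Mult PR.semiring using () renaming (_×_ to _×ᴾ_)
    open import Algebra.Properties.Semiring.Exp PR.semiring using () renaming (_^_ to _^ᴾ_)
    open ≋-Reasoning

    ^ᴾ≋^P : ∀ f k → f ^ᴾ k ≋ f ^P k
    ^ᴾ≋^P f zero    = ≋-refl
    ^ᴾ≋^P f (suc k) = *P-congʳ f (^ᴾ≋^P f k)

    p×oneP≋[] : p ×ᴾ oneP ≋ []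
    p×oneP≋[] = coeffwise λ k → trans (coeff-× p k) (p×coeff k)
      where
      coeff-× : ∀ n k → coeff (n ×ᴾ oneP) k ≈ n × coeff oneP k
      coeff-× zero    k = refl
      coeff-× (suc n) k = trans (coeff-+P oneP (n ×ᴾ oneP) k) (+-congˡ (coeff-× n k))
      p×coeff : ∀ k → p × coeff oneP k ≈ 0#
      p×coeff zero    = p×1≈0
      p×coeff (suc k) = ×-zeroʳ p

    oneP-^P : ∀ k → oneP ^P k ≋ oneP
    oneP-^P zero    = ≋-refl
    oneP-^P (suc k) = ≋-trans (*P-congʳ oneP (oneP-^P k)) (*P-identityˡ oneP)

    shift1-mono-p^ : ∀ j → shift1 (mono (p ℕ.^ j)) ≋ mono (p ℕ.^ j) +P oneP
    shift1-mono-p^ j = begin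
      shift1 (mono (p ℕ.^ j))                    ≈⟨ compose-mono (p ℕ.^ j) (X +P oneP) ⟩
      (X +P oneP) ^P (p ℕ.^ j)                   ≈⟨ ^ᴾ≋^P (X +P oneP) (p ℕ.^ j) ⟨
      (X +P oneP) ^ᴾ (p ℕ.^ j)                   ≈⟨ CharacteristicP.frobenius-^ polyRing pr p×oneP≋[] j X oneP ⟩
      X ^ᴾ (p ℕ.^ j) +P oneP ^ᴾ (p ℕ.^ j)        ≈⟨ +P-cong (^ᴾ≋^P X (p ℕ.^ j)) (^ᴾ≋^P oneP (p ℕ.^ j)) ⟩
      X ^P (p ℕ.^ j) +P oneP ^P (p ℕ.^ j)        ≈⟨ +P-cong ≋-refl (oneP-^P (p ℕ.^ j)) ⟩
      mono (p ℕ.^ j) +P oneP                     ∎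

    shift1-mono-p : shift1 (mono p) ≋ mono p +P oneP
    shift1-mono-p = ≡.subst (λ k → shift1 (mono k) ≋ mono k +P oneP) (ℕ.*-identityʳ p) (shift1-mono-p^ 1)

    Fixed-mono-p^ : ∀ j → Fixed (mono (p ℕ.^ j))
    Fixed-mono-p^ j = begin
      shift1 m +P negP (const (eval m 1#))   ≈⟨ +P-cong (shift1-mono-p^ j) (negP-cong (const-cong (eval-mono-1 (p ℕ.^ j)))) ⟩
      (m +P oneP) +P negP oneP               ≈⟨ +P-assoc m oneP (negP oneP) ⟩
      m +P (oneP +P negP oneP)               ≈⟨ +P-cong ≋-refl (+P-inverseʳ oneP) ⟩
      m +P []                                ≈⟨ +P-identityʳ m ⟩
      m                                      ∎
      where m = mono (p ℕ.^ j)

    shift1-xᵖ-x : shift1 (mono p -P X) ≋ mono p -P X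
    shift1-xᵖ-x = begin
      shift1 (mono p +P negP X)                   ≈⟨ compose-+P (mono p) (negP X) (X +P oneP) ⟩
      shift1 (mono p) +P shift1 (negP X)          ≈⟨ +P-cong shift1-mono-p (compose-negP X (X +P oneP)) ⟩
      (mono p +P oneP) +P negP (shift1 X)         ≈⟨ +P-cong ≋-refl (negP-cong (compose-X (X +P oneP))) ⟩
      (mono p +P oneP) +P negP (X +P oneP)        ≈⟨ cancel-oneP (mono p) X ⟩
      mono p +P negP X                            ∎
      where
      cancel-oneP : ∀ f g → (f +P oneP) +P negP (g +P oneP) ≋ f +P negP g
      cancel-oneP f g = begin
        (f +P oneP) +P negP (g +P oneP)        ≈⟨ +P-cong ≋-refl (negP-+P-comm g oneP) ⟨
        (f +P oneP) +P (negP g +P negP oneP)   ≈⟨ +P-medial f oneP (negP g) (negP oneP) ⟩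
        (f +P negP g) +P (oneP +P negP oneP)   ≈⟨ +P-cong ≋-refl (+P-inverseʳ oneP) ⟩
        (f +P negP g) +P []                    ≈⟨ +P-identityʳ (f +P negP g) ⟩
        f +P negP g                            ∎

    Fixed-xᵖ-x^suc : ∀ m → Fixed ((mono p -P X) ^P suc m)
    Fixed-xᵖ-x^suc m = begin
      shift1 (y ^P suc m) +P negP (const (eval (y ^P suc m) 1#))
        ≈⟨ +P-cong (compose-^P y (suc m) (X +P oneP)) (negP-cong (const-≋[] eval≈0)) ⟩
      shift1 y ^P suc m +P negP []   ≈⟨ +P-cong (^P-cong (suc m) shift1-xᵖ-x) ≋-refl ⟩
      y ^P suc m +P []               ≈⟨ +P-identityʳ (y ^P suc m) ⟩
      y ^P suc m                     ∎
      where
      y = mono p -P X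
      y[1]≈0 : eval y 1# ≈ 0#
      y[1]≈0 = trans (eval-+P (mono p) (negP X) 1#)
        (trans (+-cong (eval-mono-1 p) (trans (eval-negP X 1#) (-‿cong eval-X-1))) (-‿inverseʳ 1#))
      eval≈0 : eval (y ^P suc m) 1# ≈ 0#
      eval≈0 = trans (eval-*P y (y ^P m) 1#) (trans (*-congʳ y[1]≈0) (zeroˡ _))

  module _ (fld : IsFieldCR R) where
    open Field R fld using (*-cancelˡ-≈0)
    open import Algebra.Properties.Semiring.Mult semiring using (×-assoc-*; ×-congʳ)
    open import Algebra.Properties.Ring ring using (+-identityʳ-unique)

    -- comparing the coefficients of x^(D-1) in g(x+1) - g(1) = g leaves D g_D = 0, where D = d + 2
    Fixed⇒coeff≈0 : ∀ {g} d → Fixed g → Deg≤ g (suc (suc d)) → ¬ suc (suc d) × 1# ≈ 0# →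
                    coeff g (suc (suc d)) ≈ 0#
    Fixed⇒coeff≈0 {g} d g-fixed g≤2+d D×1≉0 =
      *-cancelˡ-≈0 D×1≉0 (trans (×-assoc-* D 1# gD) (trans (×-congʳ D (*-identityˡ gD)) (+-identityʳ-unique _ _ below-top)))
      where
      open import Relation.Binary.Reasoning.Setoid setoid
      D = suc (suc d)
      gD = coeff g D
      below-top : coeff g (suc d) + D × gD ≈ coeff g (suc d)
      below-top = begin
        coeff g (suc d) + D × gD                                    ≈⟨ coeff-shift1-subleading g (suc d) g≤2+d ⟨
        coeff (shift1 g) (suc d)                                    ≈⟨ +-identityʳ _ ⟨
        coeff (shift1 g) (suc d) + 0#                               ≈⟨ coeff-+P (shift1 g) (negP (const (eval g 1#))) (suc d) ⟨
        coeff (Amap g) (suc d)                                      ≈⟨ at g-fixed (suc d) ⟩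
        coeff g (suc d)                                             ∎

module LinearCombinations {c ℓ} (R : CommutativeRing c ℓ) where
  open import Data.List.Properties using (length-replicate)
  open import Data.List.Membership.Propositional using (_∈_)
  open import Data.List.Relation.Unary.Any using (here; there)
  import Data.List.Relation.Unary.All as All
  open All using (All; []; _∷_)
  open import Data.List.Relation.Unary.AllPairs using (AllPairs; []; _∷_)
  open import Data.List.Relation.Binary.Pointwise using (Pointwise; []; _∷_; Pointwise-length)
  open import Data.Product using (_×_)
  open import Function using (_∘_)
  open import Relation.Binary.Definitions using (tri<; tri≈; tri>)
  open CommutativeRing R hiding (zero)
  open Poly R
  open Polynomials R
  open Degrees R

  Span : List Pol → Pol → Set (c ⊔ ℓ)
  Span B f = ∃ λ (cs : List Carrier) → length cs ≡ length B × f ≋ lincomb cs B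

  lincomb-replicate-0# : ∀ B → lincomb (replicate (length B) 0#) B ≋ []
  lincomb-replicate-0# []      = ≋-refl
  lincomb-replicate-0# (b ∷ B) = +P-cong (·P-zeroˡ b refl) (lincomb-replicate-0# B)

  Span-[] : ∀ B → Span B []
  Span-[] B = replicate (length B) 0# , length-replicate (length B) , ≋-sym (lincomb-replicate-0# B)

  Span-resp-≋ : ∀ {B f g} → f ≋ g → Span B f → Span B g
  Span-resp-≋ f≋g (cs , len , f≋) = cs , len , ≋-trans (≋-sym f≋g) f≋

  lincomb-+P : ∀ B cs ds → length cs ≡ length B → length ds ≡ length B →
               ∃ λ es → length es ≡ length B × lincomb cs B +P lincomb ds B ≋ lincomb es B
  lincomb-+P []      []       []       _  _  = [] , ≡.refl , ≋-refl
  lincomb-+P (b ∷ B) (x ∷ cs) (y ∷ ds) l₁ l₂ with lincomb-+P B cs ds (ℕ.suc-injective l₁) (ℕ.suc-injective l₂)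
  ... | es , len , ≋es = (x + y) ∷ es , ≡.cong suc len ,
    ≋-trans (+P-medial (x ·P b) (lincomb cs B) (y ·P b) (lincomb ds B))
            (+P-cong (≋-sym (·P-distribʳ x y b)) ≋es)

  Span-+P : ∀ {B f g} → Span B f → Span B g → Span B (f +P g)
  Span-+P {B} (cs , len-cs , f≋) (ds , len-ds , g≋) with lincomb-+P B cs ds len-cs len-ds
  ... | es , len , ≋es = es , len , ≋-trans (+P-cong f≋ g≋) ≋es

  Span-·P-∈ : ∀ {B b} a → b ∈ B → Span B (a ·P b)
  Span-·P-∈ {b ∷ B} a (here ≡.refl) =
    a ∷ replicate (length B) 0# , ≡.cong suc (length-replicate (length B)) ,
    ≋-sym (≋-trans (+P-cong ≋-refl (lincomb-replicate-0# B)) (+P-identityʳ (a ·P b)))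
  Span-·P-∈ {b′ ∷ B} a (there b∈B) with Span-·P-∈ a b∈B
  ... | cs , len , ≋cs = 0# ∷ cs , ≡.cong suc len , ≋-trans ≋cs (≋-sym (+P-cong (·P-zeroˡ b′ refl) ≋-refl))

  coeffSum : ℕ → List Carrier → List ℕ → Carrier
  coeffSum N (c ∷ cs) (d ∷ ds) with d ℕ.≟ N
  ... | yes _ = c + coeffSum N cs ds
  ... | no  _ = coeffSum N cs ds
  coeffSum N _        _        = 0#

  VanishFrom : ℕ → List Carrier → List ℕ → Set (c ⊔ ℓ)
  VanishFrom N = Pointwise (λ c d → N ≤ d → c ≈ 0#)

  coeff-lincomb : ∀ N {cs bs ds} → Pointwise MonicOfDegree bs ds → VanishFrom (suc N) cs ds →
                  coeff (lincomb cs bs) N ≈ coeffSum N cs ds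
  coeff-lincomb N []                  []                = refl
  coeff-lincomb N {c ∷ cs} {b ∷ bs} {d ∷ ds} ((b≤d , bd≈1) ∷ monic) (c≈0 ∷ vanish) with d ℕ.≟ N
  ... | yes ≡.refl = trans (coeff-+P (c ·P b) (lincomb cs bs) N)
                      (+-cong (trans (coeff-·P c b N) (trans (*-congˡ bd≈1) (*-identityʳ c))) (coeff-lincomb N monic vanish))
  ... | no d≢N = trans (coeff-+P (c ·P b) (lincomb cs bs) N)
                  (trans (+-congʳ (trans (coeff-·P c b N) cbN≈0)) (trans (+-identityˡ _) (coeff-lincomb N monic vanish)))
    where
    cbN≈0 : c * coeff b N ≈ 0#
    cbN≈0 with ℕ.<-cmp d N
    ... | tri< d<N _ _ = trans (*-congˡ (b≤d N d<N)) (zeroʳ c)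
    ... | tri≈ _ d≡N _ = contradiction d≡N d≢N
    ... | tri> _ _ N<d = trans (*-congʳ (c≈0 N<d)) (zeroˡ _)

  coeffSum-absent : ∀ N cs {ds} → All (_≢ N) ds → coeffSum N cs ds ≈ 0#
  coeffSum-absent N []       _              = refl
  coeffSum-absent N (c ∷ cs) []             = refl
  coeffSum-absent N (c ∷ cs) {d ∷ ds} (d≢N ∷ absent) with d ℕ.≟ N
  ... | yes d≡N = contradiction d≡N d≢N
  ... | no  _   = coeffSum-absent N cs absent

  vanish-lower : ∀ {N cs ds} → All (_≢ N) ds → VanishFrom (suc N) cs ds → VanishFrom N cs ds
  vanish-lower []               []               = []
  vanish-lower (d≢N ∷ absent) (c≈0 ∷ vanish) =
    (λ N≤d → c≈0 (ℕ.≤∧≢⇒< N≤d (d≢N ∘ ≡.sym))) ∷ vanish-lower absent vanish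

  -- distinct degrees: at most one coefficient contributes to coeffSum N
  vanish-step : ∀ {N cs ds} → AllPairs _≢_ ds → VanishFrom (suc N) cs ds → coeffSum N cs ds ≈ 0# → VanishFrom N cs ds
  vanish-step []                  []               _ = []
  vanish-step {N} {c ∷ cs} {d ∷ ds} (d≢ds ∷ distinct) (c≈0 ∷ vanish) sum≈0 with d ℕ.≟ N
  ... | yes ≡.refl = (λ _ → c≈0′) ∷ vanish-lower absent vanish
    where
    absent = All.map (λ d≢d′ → d≢d′ ∘ ≡.sym) d≢ds
    c≈0′ = trans (sym (+-identityʳ c)) (trans (+-congˡ (sym (coeffSum-absent N cs absent))) sum≈0)
  ... | no d≢N = (λ N≤d → c≈0 (ℕ.≤∧≢⇒< N≤d (d≢N ∘ ≡.sym))) ∷ vanish-step distinct vanish sum≈0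

  VanishFrom-above : ∀ N {cs ds} → length cs ≡ length ds → All (_< N) ds → VanishFrom N cs ds
  VanishFrom-above N {[]}     {[]}     _   []             = []
  VanishFrom-above N {c ∷ cs} {d ∷ ds} len (d<N ∷ bound) =
    (λ N≤d → contradiction N≤d (ℕ.<⇒≱ d<N)) ∷ VanishFrom-above N (ℕ.suc-injective len) bound

  VanishFrom-0⇒AllZero : ∀ {cs ds} → VanishFrom 0 cs ds → AllZero cs
  VanishFrom-0⇒AllZero []               k       = refl
  VanishFrom-0⇒AllZero (c≈0 ∷ vanish) zero    = c≈0 z≤n
  VanishFrom-0⇒AllZero (c≈0 ∷ vanish) (suc k) = VanishFrom-0⇒AllZero vanish k

  monic-distinctDegrees-independent : ∀ N {cs bs ds} → Pointwise MonicOfDegree bs ds → AllPairs _≢_ ds →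
                                      All (_< N) ds → length cs ≡ length bs → lincomb cs bs ≋ [] → AllZero cs
  monic-distinctDegrees-independent N {cs} {bs} {ds} monic distinct bound len lincomb≋[] =
    VanishFrom-0⇒AllZero (descend N (VanishFrom-above N (≡.trans len (Pointwise-length monic)) bound))
    where
    descend : ∀ M → VanishFrom M cs ds → VanishFrom 0 cs ds
    descend zero    vanish = vanish
    descend (suc M) vanish =
      descend M (vanish-step distinct vanish (trans (sym (coeff-lincomb M monic vanish)) (at lincomb≋[] M)))

module Family {c ℓ} (R : CommutativeRing c ℓ) {p n : ℕ} (pr : Prime p) (3≤q : 3 ≤ p ℕ.^ n) where
  open import Data.Nat using (_∸_; _^_)
  open import Data.List.Properties using (length-++; length-map; length-upTo)
  open import Data.List.Membership.Propositional using (_∈_)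
  open import Data.List.Membership.Propositional.Properties
    using (∈-map⁻; ∈-map⁺; ∈-upTo⁻; ∈-upTo⁺; ∈-++⁻; ∈-++⁺ˡ; ∈-++⁺ʳ; ∈-filter⁻; ∈-filter⁺)
  open import Data.List.Relation.Unary.Any using (here)
  import Data.List.Relation.Unary.All as All
  import Data.List.Relation.Unary.All.Properties as All
  open import Data.List.Relation.Unary.AllPairs using (AllPairs)
  import Data.List.Relation.Unary.Unique.Propositional.Properties as Unique
  open import Data.List.Relation.Binary.Pointwise as Pointwise using (Pointwise)
  open import Data.Product using () renaming (_×_ to _∧_)
  open CommutativeRing R hiding (zero)
  open import Algebra.Properties.Ring ring using (-0#≈0#)
  open import Algebra.Properties.Semiring.Mult semiring using (_×_)
  open Poly R
  open Polynomials R
  open Degrees R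
  open FixedPoints R
  open LinearCombinations R
  open PowersOf p (prime⇒2≤ pr)
  open PrimePowerBounds p n (prime⇒2≤ pr) 3≤q

  xᵖ-x : Pol
  xᵖ-x = mono p -P X

  M : ℕ
  M = p ^ (n ∸ 1) ∸ 1

  nonPowers : List ℕ
  nonPowers = filter isNonPowerOf? (rangeℕ 2 M)

  degrees : List ℕ
  degrees = map (p ^_) (upTo n) ++ map (ℕ._* p) nonPowers

  ∈-nonPowers⁻ : ∀ {m} → m ∈ nonPowers → 2 ≤ m ∧ m ≤ M
  ∈-nonPowers⁻ m∈ = ∈-rangeℕ⁻ {a = 2} {b = M} (proj₁ (∈-filter⁻ isNonPowerOf? {xs = rangeℕ 2 M} m∈))

  MonicOfDegree-xᵖ-x : MonicOfDegree xᵖ-x p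
  MonicOfDegree-xᵖ-x = Deg≤-+P {mono p} {negP X} (proj₁ (MonicOfDegree-mono p)) (Deg≤-negP {X} X≤p) , xᵖ-x[p]≈1
    where
    X≤p : Deg≤ X p
    X≤p = Deg≤-weaken {X} (ℕ.≤-trans (s≤s z≤n) (prime⇒2≤ pr)) (proj₁ MonicOfDegree-X)
    xᵖ-x[p]≈1 : coeff xᵖ-x p ≈ 1#
    xᵖ-x[p]≈1 = trans (coeff-+P (mono p) (negP X) p) (trans (+-cong (proj₂ (MonicOfDegree-mono p)) -X[p]≈0) (+-identityʳ 1#))
      where -X[p]≈0 = trans (coeff-negP X p) (trans (-‿cong (proj₁ MonicOfDegree-X p (prime⇒2≤ pr))) -0#≈0#)

  coeff-mono-0 : ∀ k → 1 ≤ k → coeff (mono k) 0 ≈ 0#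
  coeff-mono-0 (suc k) _ = coeff-^P-0 X k refl

  coeff-xᵖ-x-0 : coeff xᵖ-x 0 ≈ 0#
  coeff-xᵖ-x-0 = trans (coeff-+P (mono p) (negP X) 0)
    (trans (+-cong (coeff-mono-0 p (ℕ.≤-trans (s≤s z≤n) (prime⇒2≤ pr))) (trans (coeff-negP X 0) -0#≈0#)) (+-identityʳ 0#))

  ∈-family⁻ : ∀ {b} → b ∈ family p n →
              (∃ λ j → j < n ∧ b ≡ mono (p ^ j)) ⊎ (∃ λ m → (2 ≤ m ∧ m ≤ M) ∧ b ≡ xᵖ-x ^P m)
  ∈-family⁻ b∈ with ∈-++⁻ (map (λ j → mono (p ^ j)) (upTo n)) b∈
  ... | inj₁ b∈monos with ∈-map⁻ (λ j → mono (p ^ j)) b∈monos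
  ...   | j , j∈ , b≡ = inj₁ (j , ∈-upTo⁻ j∈ , b≡)
  ∈-family⁻ b∈ | inj₂ b∈powers with ∈-map⁻ (xᵖ-x ^P_) b∈powers
  ...   | m , m∈ , b≡ = inj₂ (m , ∈-nonPowers⁻ m∈ , b≡)

  mono-∈-family : ∀ {j} → j < n → mono (p ^ j) ∈ family p n
  mono-∈-family j<n = ∈-++⁺ˡ (∈-map⁺ (λ j → mono (p ^ j)) (∈-upTo⁺ j<n))

  xᵖ-x^-∈-family : ∀ {m} → 2 ≤ m → m ≤ M → ¬ IsPowerOf p m → xᵖ-x ^P m ∈ family p n
  xᵖ-x^-∈-family 2≤m m≤M m-nonPower =
    ∈-++⁺ʳ (map (λ j → mono (p ^ j)) (upTo n)) (∈-map⁺ (xᵖ-x ^P_) (∈-filter⁺ isNonPowerOf? (∈-rangeℕ⁺ 2≤m m≤M) m-nonPower))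

  family-monic : Pointwise MonicOfDegree (family p n) degrees
  family-monic = Pointwise.++⁺
    (map-monic (λ j → mono (p ^ j)) (p ^_) (λ j → MonicOfDegree-mono (p ^ j)) (upTo n))
    (map-monic (xᵖ-x ^P_) (ℕ._* p) (λ m → MonicOfDegree-^P xᵖ-x m MonicOfDegree-xᵖ-x) nonPowers)
    where
    map-monic : ∀ (f : ℕ → Pol) d → (∀ x → MonicOfDegree (f x) (d x)) → ∀ xs → Pointwise MonicOfDegree (map f xs) (map d xs)
    map-monic f d monic []       = Pointwise.[]
    map-monic f d monic (x ∷ xs) = monic x Pointwise.∷ map-monic f d monic xs

  monoDegrees∩powerDegrees≡∅ : ∀ {d} → ¬ (d ∈ map (p ^_) (upTo n) ∧ d ∈ map (ℕ._* p) nonPowers)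
  monoDegrees∩powerDegrees≡∅ (d∈₁ , d∈₂) with ∈-map⁻ (p ^_) d∈₁ | ∈-map⁻ (ℕ._* p) d∈₂
  ... | j , _ , d≡p^j | m , m∈ , d≡m*p with j
  ...   | zero   = ℕ.<⇒≢ (ℕ.≤-trans (s≤s (s≤s z≤n)) (ℕ.*-mono-≤ (proj₁ (∈-nonPowers⁻ m∈)) (prime⇒2≤ pr)))
                          (≡.trans (≡.sym d≡p^j) d≡m*p)
  ...   | suc j′ = proj₂ (∈-filter⁻ isNonPowerOf? {xs = rangeℕ 2 M} m∈) (IsPowerOf⁺ {j′} (≡.sym (ℕ.*-cancelʳ-≡ m (p ^ j′) p
                      (≡.trans (≡.sym d≡m*p) (≡.trans d≡p^j (ℕ.*-comm p (p ^ j′)))))))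

  degrees-distinct : AllPairs _≢_ degrees
  degrees-distinct = Unique.++⁺ (Unique.map⁺ ^-injective (Unique.upTo⁺ n))
    (Unique.map⁺ (λ {a} {b} → ℕ.*-cancelʳ-≡ a b p)
      (Unique.filter⁺ isNonPowerOf? (Unique.map⁺ (λ {a} {b} → ℕ.+-cancelʳ-≡ 2 a b) (Unique.upTo⁺ (suc M ∸ 2)))))
    monoDegrees∩powerDegrees≡∅

  degrees-bounded : All.All (_< suc (q ∸ 2)) degrees
  degrees-bounded = All.++⁺
    (All.map⁺ (All.tabulate λ {j} j∈ → s≤s (p^j≤q∸2 j (∈-upTo⁻ j∈))))
    (All.map⁺ (All.tabulate λ {m} m∈ → s≤s (m*p≤q∸2 m (proj₂ (∈-nonPowers⁻ m∈)))))

  family-hasMonicOfDegree : ∀ D → 1 ≤ D → D ≤ q ∸ 2 → D ≡ 1 ⊎ p ∣ D → ∃ λ b → b ∈ family p n ∧ MonicOfDegree b D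
  family-hasMonicOfDegree D _ _ (inj₁ ≡.refl) =
    mono (p ^ 0) , mono-∈-family 1≤n , MonicOfDegree-mono 1
  family-hasMonicOfDegree D 1≤D D≤ (inj₂ (divides m D≡m*p)) with isPowerOf? m
  ... | yes m-power with IsPowerOf⁻ m-power
  ...   | k , p^k≡m =
    mono (p ^ suc k) , mono-∈-family (p^k≤q∸2⇒k<n (suc k) (≡.subst (_≤ q ∸ 2) D≡p^1+k D≤)) ,
    ≡.subst (MonicOfDegree (mono (p ^ suc k))) (≡.sym D≡p^1+k) (MonicOfDegree-mono (p ^ suc k))
    where
    D≡p^1+k : D ≡ p ^ suc k
    D≡p^1+k = ≡.trans D≡m*p (≡.trans (≡.cong (ℕ._* p) (≡.sym p^k≡m)) (ℕ.*-comm (p ^ k) p))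
  family-hasMonicOfDegree D 1≤D D≤ (inj₂ (divides m D≡m*p)) | no m-nonPower =
    xᵖ-x ^P m , xᵖ-x^-∈-family (2≤m m D≡m*p m-nonPower) m≤M m-nonPower ,
    ≡.subst (MonicOfDegree (xᵖ-x ^P m)) (≡.sym D≡m*p) (MonicOfDegree-^P xᵖ-x m MonicOfDegree-xᵖ-x)
    where
    m≤M : m ≤ M
    m≤M = m*p≤q∸2⇒ m (≡.subst (_≤ q ∸ 2) D≡m*p D≤)
    2≤m : ∀ m → D ≡ m ℕ.* p → ¬ IsPowerOf p m → 2 ≤ m
    2≤m zero          D≡0 _          = contradiction (ℕ.≤-reflexive D≡0) (ℕ.<⇒≱ 1≤D)
    2≤m (suc zero)    _   m-nonPower = contradiction (here ≡.refl) m-nonPower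
    2≤m (suc (suc _)) _   _          = s≤s (s≤s z≤n)

  length-family : length (family p n) ≡ p ^ (n ∸ 1)
  length-family = ≡.trans (length-++ (map (λ j → mono (p ^ j)) (upTo n)))
    (≡.trans (≡.cong₂ ℕ._+_ (≡.trans (length-map _ (upTo n)) (length-upTo n)) (length-map _ nonPowers))
             (Counting.length-nonPowers p (prime⇒2≤ pr) n 1≤n))

  degree-cases : ∀ d → (suc d ≡ 1 ⊎ p ∣ suc d) ⊎ (∃ λ e → d ≡ suc e ∧ ¬ p ∣ suc d)
  degree-cases zero    = inj₁ (inj₁ ≡.refl)
  degree-cases (suc e) with p ∣? suc (suc e)
  ... | yes p∣ = inj₁ (inj₂ p∣)
  ... | no  p∤ = inj₂ (e , ≡.refl , p∤)

  module _ (p×1≈0 : p × 1# ≈ 0#) where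

    family-InV-Fixed : ∀ b → b ∈ family p n → InV (q ∸ 2) b ∧ Fixed b
    family-InV-Fixed b b∈ with ∈-family⁻ b∈
    ... | inj₁ (j , j<n , ≡.refl) =
      (Deg≤-weaken {mono (p ^ j)} (p^j≤q∸2 j j<n) (proj₁ (MonicOfDegree-mono (p ^ j))) , coeff-mono-0 (p ^ j) (ℕ.m^n>0 p j)) ,
      Fixed-mono-p^ pr p×1≈0 j
    ... | inj₂ (suc m , (_ , 1+m≤M) , ≡.refl) =
      (Deg≤-weaken {xᵖ-x ^P suc m} (m*p≤q∸2 (suc m) 1+m≤M) (proj₁ (MonicOfDegree-^P xᵖ-x (suc m) MonicOfDegree-xᵖ-x)) ,
       coeff-^P-0 xᵖ-x m coeff-xᵖ-x-0) ,
      Fixed-xᵖ-x^suc pr p×1≈0 m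

    module _ (fld : IsFieldCR R) where
      open CharacteristicP R using (×1≈0⇒prime∣)

      Fixed⇒Span : ∀ D → D ≤ q ∸ 2 → ∀ g → Fixed g → Deg≤ g D → coeff g 0 ≈ 0# → Span (family p n) g
      Fixed⇒Span zero _ g _ g≤0 g[0]≈0 = Span-resp-≋ (≋-sym g≋[]) (Span-[] (family p n))
        where g≋[] = coeffwise λ { zero → g[0]≈0 ; (suc k) → g≤0 (suc k) (s≤s z≤n) }
      Fixed⇒Span (suc d) D≤ g g-fixed g≤1+d g[0]≈0 with degree-cases d
      ... | inj₁ in-family with family-hasMonicOfDegree (suc d) (s≤s z≤n) D≤ in-family
      ...   | b , b∈ , b-monic =
        Span-resp-≋ g′+cb≋g (Span-+P (Fixed⇒Span d d≤q∸2 g′ g′-fixed g′≤d g′[0]≈0) (Span-·P-∈ lc b∈))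
        where
        d≤q∸2 = ℕ.≤-trans (ℕ.n≤1+n d) D≤
        lc = coeff g (suc d)
        g′ = g -P lc ·P b
        b-InV-Fixed = family-InV-Fixed b b∈
        g′-fixed : Fixed g′
        g′-fixed = Fixed-+P {g} {negP (lc ·P b)} g-fixed (Fixed-negP {lc ·P b} (Fixed-·P {b} lc (proj₂ b-InV-Fixed)))
        g′≤d : Deg≤ g′ d
        g′≤d = Deg≤-cancel-top g b d g≤1+d b-monic
        g′[0]≈0 : coeff g′ 0 ≈ 0#
        g′[0]≈0 = trans (coeff-subtract-·P g lc b 0)
          (trans (+-cong g[0]≈0 (trans (-‿cong (trans (*-congˡ (proj₂ (proj₁ b-InV-Fixed))) (zeroʳ lc))) -0#≈0#)) (+-identityʳ 0#))
        g′+cb≋g : g′ +P lc ·P b ≋ g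
        g′+cb≋g = ≋-trans (+P-assoc g (negP (lc ·P b)) (lc ·P b))
                          (≋-trans (+P-cong ≋-refl (+P-inverseˡ (lc ·P b))) (+P-identityʳ g))
      Fixed⇒Span (suc d) D≤ g g-fixed g≤1+d g[0]≈0 | inj₂ (e , ≡.refl , p∤D) =
        Fixed⇒Span d (ℕ.≤-trans (ℕ.n≤1+n d) D≤) g g-fixed (Deg≤-lower {g} g≤1+d top≈0) g[0]≈0
        where
        top≈0 : coeff g (suc d) ≈ 0#
        top≈0 = Fixed⇒coeff≈0 fld e g-fixed g≤1+d (λ D×1≈0 → p∤D (×1≈0⇒prime∣ (proj₁ fld) pr p×1≈0 D×1≈0))

open import Data.Nat using (_^_; _∸_)
open import Data.List.Membership.Propositional using (_∈_)
open import Data.Product using (_×_)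

lemma5 : ∀ {c ℓ} (R : CommutativeRing c ℓ) (p n : ℕ) → Prime p → 3 ≤ p ^ n →
         IsFieldCR R → HasCardinality R (p ^ n) →
         let open Poly R in
         let open CommutativeRing R using (Carrier) in
         let q = p ^ n in
         let B = family p n in
         -- every listed polynomial lies in V[x] and in ker(A - I)
         (∀ b → b ∈ B → InV (q ∸ 2) b × Amap b ≈P b)
         -- they span ker(A - I)
         × (∀ f → InV (q ∸ 2) f → Amap f ≈P f →
              ∃ λ (cs : List Carrier) → length cs ≡ length B × f ≈P lincomb cs B)
         -- they are linearly independent
         × (∀ (cs : List Carrier) → length cs ≡ length B → lincomb cs B ≈P [] → AllZero cs)
         -- hence dim ker(A - I) = p^(n-1)
         × length B ≡ p ^ (n ∸ 1)
lemma5 R p n pr 3≤q fld card = fixed , spanning , independent , length-family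
  where
  open CommutativeRing R using (Carrier)
  open Poly R
  open Polynomials R using (coeffwise; at)
  open LinearCombinations R using (monic-distinctDegrees-independent)
  open Family R {p} {n} pr 3≤q
  open PrimePowerBounds p n (prime⇒2≤ pr) 3≤q using (q)
  B = family p n
  p×1≈0 = Field.p^n-elements⇒p×1≈0 R fld {p} {n} card

  fixed : ∀ b → b ∈ B → InV (q ∸ 2) b × Amap b ≈P b
  fixed b b∈ = let (b∈V , b-fixed) = family-InV-Fixed p×1≈0 b b∈ in b∈V , at b-fixed

  spanning : ∀ f → InV (q ∸ 2) f → Amap f ≈P f → ∃ λ (cs : List Carrier) → length cs ≡ length B × f ≈P lincomb cs B
  spanning f (f≤ , f[0]≈0) f-fixed =
    let (cs , len , f≋) = Fixed⇒Span p×1≈0 fld (q ∸ 2) ℕ.≤-refl f (coeffwise f-fixed) f≤ f[0]≈0 in cs , len , at f≋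

  independent : ∀ cs → length cs ≡ length B → lincomb cs B ≈P [] → AllZero cs
  independent cs len lincomb≈0 =
    monic-distinctDegrees-independent (suc (q ∸ 2)) {cs} family-monic degrees-distinct degrees-bounded len (coeffwise lincomb≈0)
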